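{- Let $p$ be a prime, $A=\{\mathbf a_1,\dots,\mathbf a_N\}\subseteq\mathbb Z^n$, and let $\gamma\in\mathbb NA$ be good. Fix $u^{(0)}\in U^+_{\min}(\gamma)$ and put $v^{(0)}=u^{(0)}/(1-p)\in\mathbb Q^N$. Assume $v^{(0)}$ has minimal negative support, i.e. there is no $l\in L$ with $\mathrm{nsupp}(v^{(0)}+l)$ a proper subset of $\mathrm{nsupp}(v^{(0)})$. Let $\pi$ satisfy $\pi^{p-1}=-p$, let $N_{v^{(0)}}=\{l\in L:\mathrm{nsupp}(v^{(0)}+l)=\mathrm{nsupp}(v^{(0)})\}$, $N'_{v^{(0)}}=\{l\in N_{v^{(0)}}: u^{(0)}+l\in U^+_{p-1}(\gamma)\}$, and $$G_{v^{(0)}}(\lambda)=\sum_{l\in N'_{v^{(0)}}}\frac{[v^{(0)}]_{l_- }}{[v^{(0)}+l]_{l_+}}\,\pi^{\sum_i(u^{(0)}_i+l_i)}\lambda_1^{u^{(0)}_1+l_1}\cdots\lambda_N^{u^{(0)}_N+l_N}\in\mathbb Q(\pi)[\lambda_1,\dots,\lambda_N].$$ Then $\pi^{ -w(\gamma)}G_{v^{(0)}}(\lambda)$ has $p$-integral coefficients (in $\mathbb Z_p[\pi]$) and $$\pi^{ -w(\gamma)}G_{v^{(0)}}(\lambda)\equiv (u^{(0)}_1!)\cdots(u^{(0)}_N!)\,F_\gamma(\lambda)\pmod{\pi},$$ coefficientwise, where the residue field of $\mathbb Z_p[\pi]$ is identified with $\mathbb F_p$.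
   Context: $\mathbb N=\{0,1,\dots\}$, $\mathbb NA=\{\sum_ic_i\mathbf a_i:c_i\in\mathbb N\}$, $L=\{l\in\mathbb Z^N:\sum_il_i\mathbf a_i=\mathbf 0\}$. For $\gamma\in\mathbb NA$: $U^+(\gamma)=\{u\in\mathbb N^N:\sum_iu_i\mathbf a_i=\gamma\}$, $U^+_{p-1}(\gamma)=\{u\in U^+(\gamma):u_i\le p-1\ \forall i\}$, $w(\gamma)=\min\{\sum_iu_i:u\in U^+(\gamma)\}$, $U^+_{\min}(\gamma)=\{u\in U^+(\gamma):\sum_iu_i=w(\gamma)\}$; $\gamma$ is good if $U^+_{\min}(\gamma)\subseteq U^+_{p-1}(\gamma)$, and then $F_\gamma(\lambda)=\sum_{u\in U^+_{\min}(\gamma)}\frac{\lambda_1^{u_1}\cdots\lambda_N^{u_N}}{u_1!\cdots u_N!}\in\mathbb F_p[\lambda]$. For $x\in\mathbb C^N$, $\mathrm{nsupp}(x)=\{i: x_i\in\mathbb Z_{<0}\}$. For $l\in\mathbb Z^N$, $l_+=(\max(l_i,0))_i$, $l_-=(\max(-l_i,0))_i$, and for $v\in\mathbb Q^N$: $[v]_{l_- }=\prod_{l_i<0}\prod_{j=1}^{ -l_i}(v_i-j+1)$, $[v+l]_{l_+}=\prod_{l_i>0}\prod_{j=1}^{l_i}(v_i+j)$. -}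

module Defs where

open import Data.Bool using (Bool; true; false; if_then_else_; _∧_; not)
open import Data.Nat as ℕ using (ℕ; zero; suc; _∸_; _!; NonZero)
open import Data.Nat.Properties using (_!≢0; m^n≢0)
open import Data.Nat.Primality using (Prime; prime⇒nonZero; prime⇒nonTrivial)
open import Data.Nat.Divisibility using (_∣_)
open import Data.Integer as ℤ using (ℤ; +_; -[1+_])
import Data.Integer.Properties as ℤP
open import Data.Rational as ℚ using (ℚ; 0ℚ; 1ℚ)
import Data.Rational.Properties as ℚP
open import Data.Fin using (Fin; zero; suc; toℕ; fromℕ<)
open import Data.Fin.Properties using (all?)
open import Data.Fin.Subset using (Subset; _⊂_)
open import Data.Vec using (Vec; replicate; zipWith; tabulate; map)
open import Data.Vec.Properties using (≡-dec)
import Data.Bool.Properties as BoolP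
open import Data.Product using (Σ; _×_; _,_)
open import Relation.Nullary using (¬_; Dec; yes; no)
open import Relation.Nullary.Decidable using (⌊_⌋)
open import Relation.Binary.PropositionalEquality using (_≡_)

foldFin : {A : Set} → A → (A → A → A) → {N : ℕ} → (Fin N → A) → A
foldFin e _⊕_ {zero}  f = e
foldFin e _⊕_ {suc N} f = f zero ⊕ foldFin e _⊕_ (λ i → f (suc i))

sumℕ : {N : ℕ} → (Fin N → ℕ) → ℕ
sumℕ = foldFin 0 ℕ._+_

prodℚ : {N : ℕ} → (Fin N → ℚ) → ℚ
prodℚ = foldFin 1ℚ ℚ._*_

-- The configuration A = {a_1,...,a_N} ⊆ ℤ^n is given as a : Fin N → Vec ℤ n.

vzero : {n : ℕ} → Vec ℤ n
vzero = replicate _ (+ 0)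

vadd : {n : ℕ} → Vec ℤ n → Vec ℤ n → Vec ℤ n
vadd = zipWith ℤ._+_

lincomb : {n N : ℕ} → (Fin N → Vec ℤ n) → (Fin N → ℤ) → Vec ℤ n
lincomb a c = foldFin vzero vadd (λ i → map (c i ℤ.*_) (a i))

ofℕ : {N : ℕ} → (Fin N → ℕ) → (Fin N → ℤ)
ofℕ u i = + u i

InL : {n N : ℕ} → (Fin N → Vec ℤ n) → (Fin N → ℤ) → Set
InL a l = lincomb a l ≡ vzero

InU : {n N : ℕ} → (Fin N → Vec ℤ n) → Vec ℤ n → (Fin N → ℕ) → Set
InU a γ u = lincomb a (ofℕ u) ≡ γ

InNA : {n N : ℕ} → (Fin N → Vec ℤ n) → Vec ℤ n → Set
InNA a γ = Σ (_ → ℕ) (λ u → InU a γ u)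

weight : {N : ℕ} → (Fin N → ℕ) → ℕ
weight = sumℕ

IsW : {n N : ℕ} → (Fin N → Vec ℤ n) → Vec ℤ n → ℕ → Set
IsW a γ w = Σ (_ → ℕ) (λ u → InU a γ u × weight u ≡ w)
          × (∀ u → InU a γ u → w ℕ.≤ weight u)

InUmin : {n N : ℕ} → (Fin N → Vec ℤ n) → Vec ℤ n → ℕ → (Fin N → ℕ) → Set
InUmin a γ w u = InU a γ u × weight u ≡ w

InUp1 : {n N : ℕ} → ℕ → (Fin N → Vec ℤ n) → Vec ℤ n → (Fin N → ℕ) → Set
InUp1 p a γ u = InU a γ u × (∀ i → u i ℕ.≤ p ∸ 1)

Good : {n N : ℕ} → ℕ → (Fin N → Vec ℤ n) → Vec ℤ n → ℕ → Set
Good p a γ w = ∀ u → InUmin a γ w u → InUp1 p a γ u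

-- x ∈ ℤ_{<0}  (ℚ is normalised: x is an integer iff its denominator is 1)
isNegInt : ℚ → Bool
isNegInt x = (ℚ.denominatorℕ x ℕ.≡ᵇ 1) ∧ not (+ 0 ℤ.≤ᵇ ℚ.numerator x)

nsupp : {N : ℕ} → (Fin N → ℚ) → Subset N
nsupp x = tabulate (λ i → isNegInt (x i))

qadd : {N : ℕ} → (Fin N → ℚ) → (Fin N → ℤ) → (Fin N → ℚ)
qadd v l i = v i ℚ.+ (l i ℚ./ 1)

pm1≢0 : {p : ℕ} → Prime p → NonZero (p ∸ 1)
pm1≢0 {p} pr with ℕ.nonTrivial⇒n>1 p {{prime⇒nonTrivial pr}}
... | ℕ.s≤s (ℕ.s≤s _) = _

-- v^(0) = u^(0) / (1 - p) = - u^(0) / (p - 1)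
vzeroOf : {N : ℕ} (p : ℕ) → Prime p → (Fin N → ℕ) → (Fin N → ℚ)
vzeroOf p pr u i = ℚ._/_ (ℤ.- (+ u i)) (p ∸ 1) {{pm1≢0 pr}}

MinNegSupp : {n N : ℕ} → (Fin N → Vec ℤ n) → (Fin N → ℚ) → Set
MinNegSupp a v = ¬ Σ (_ → ℤ) (λ l → InL a l × (nsupp (qadd v l) ⊂ nsupp v))

falling : ℚ → ℕ → ℚ
falling x zero    = 1ℚ
falling x (suc m) = falling x m ℚ.* (x ℚ.- (+ m ℚ./ 1))

rising : ℚ → ℕ → ℚ
rising x zero    = 1ℚ
rising x (suc m) = rising x m ℚ.* (x ℚ.+ (+ suc m ℚ./ 1))

bracketMinus : {N : ℕ} → (Fin N → ℚ) → (Fin N → ℤ) → ℚ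
bracketMinus v l = prodℚ (λ i → f (v i) (l i))
  where
  f : ℚ → ℤ → ℚ
  f x (+ _)      = 1ℚ
  f x -[1+ m ]   = falling x (suc m)

bracketPlus : {N : ℕ} → (Fin N → ℚ) → (Fin N → ℤ) → ℚ
bracketPlus v l = prodℚ (λ i → f (v i) (l i))
  where
  f : ℚ → ℤ → ℚ
  f x (+ m)      = rising x m
  f x -[1+ _ ]   = 1ℚ

-- total division (x / 0 := 0); only used where the divisor is nonzero
divℚ : ℚ → ℚ → ℚ
divℚ x y with y ℚP.≟ 0ℚ
... | yes _ = 0ℚ
... | no y≢0 = ℚ._÷_ x y {{ℚ.≢-nonZero y≢0}}

-- The field ℚ(π), π^{p-1} = -p.  Since x^{p-1}+p is Eisenstein,
-- ℚ(π) ≅ ℚ[x]/(x^{p-1}+p); an element Σ_{j<p-1} b_j π^j is stored as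
-- its coordinate vector b : Fin (p-1) → ℚ in the basis 1, π, …, π^{p-2}.

Qπ : ℕ → Set
Qπ p = Fin (p ∸ 1) → ℚ

zeroπ : (p : ℕ) → Qπ p
zeroπ p j = 0ℚ

addπ : (p : ℕ) → Qπ p → Qπ p → Qπ p
addπ p x y j = x j ℚ.+ y j

subπ : (p : ℕ) → Qπ p → Qπ p → Qπ p
subπ p x y j = x j ℚ.- y j

constπ : (p : ℕ) → ℚ → Qπ p
constπ p t j = if toℕ j ℕ.≡ᵇ 0 then t else 0ℚ

negPow : (p : ℕ) → Prime p → ℤ → ℚ
negPow p pr (+ m)      = ((ℤ.- (+ p)) ℤ.^ m) ℚ./ 1
negPow p pr -[1+ m ]   =
  ℚ._/_ ((ℤ.- (+ 1)) ℤ.^ suc m) (p ℕ.^ suc m) {{m^n≢0 p (suc m) {{prime⇒nonZero pr}}}}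

-- c · π^k  for c ∈ ℚ, k ∈ ℤ :  writing k = q(p-1) + r, 0 ≤ r < p-1,
-- c π^k = c (-p)^q π^r.
monoπ : (p : ℕ) → Prime p → ℚ → ℤ → Qπ p
monoπ p pr c k j =
  if toℕ j ℕ.≡ᵇ ℤ._%ℕ_ k (p ∸ 1) {{pm1≢0 pr}}
  then c ℚ.* negPow p pr (ℤ._/ℕ_ k (p ∸ 1) {{pm1≢0 pr}})
  else 0ℚ

mulπpow : (p : ℕ) → Prime p → ℤ → Qπ p → Qπ p
mulπpow p pr k x = foldFin (zeroπ p) (addπ p)
  (λ j → monoπ p pr (x j) (k ℤ.+ + toℕ j))

mulπ : (p : ℕ) → Prime p → Qπ p → Qπ p
mulπ p pr x = mulπpow p pr (+ 1) x

-- ℤ_(p) = ℚ ∩ ℤ_p  (reduced fractions with denominator prime to p)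
IntZp : ℕ → ℚ → Set
IntZp p x = ¬ (p ∣ ℚ.denominatorℕ x)

-- x ∈ ℤ_(p)[π] = ℚ(π) ∩ ℤ_p[π]  (p-integral element)
IntegralQπ : (p : ℕ) → Qπ p → Set
IntegralQπ p x = ∀ j → IntZp p (x j)

InπIdeal : (p : ℕ) → Prime p → Qπ p → Set
InπIdeal p pr x = Σ (Qπ p) (λ b → IntegralQπ p b × (∀ j → x j ≡ mulπ p pr b j))

InUᵇ : {n N : ℕ} → (Fin N → Vec ℤ n) → Vec ℤ n → (Fin N → ℕ) → Bool
InUᵇ a γ u = ⌊ ≡-dec ℤP._≟_ (lincomb a (ofℕ u)) γ ⌋

InLᵇ : {n N : ℕ} → (Fin N → Vec ℤ n) → (Fin N → ℤ) → Bool
InLᵇ a l = ⌊ ≡-dec ℤP._≟_ (lincomb a l) vzero ⌋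

InUp1ᵇ : {n N : ℕ} → ℕ → (Fin N → Vec ℤ n) → Vec ℤ n → (Fin N → ℕ) → Bool
InUp1ᵇ p a γ u = InUᵇ a γ u ∧ ⌊ all? (λ i → u i ℕ.≤? p ∸ 1) ⌋

InUminᵇ : {n N : ℕ} → (Fin N → Vec ℤ n) → Vec ℤ n → ℕ → (Fin N → ℕ) → Bool
InUminᵇ a γ w u = InUᵇ a γ u ∧ (weight u ℕ.≡ᵇ w)

-- Every monomial exponent e ∈ ℕ^N is u^(0)+l for exactly one l = e - u^(0);
-- the following decides whether this l lies in N'_{v}.
lOf : {N : ℕ} → (Fin N → ℕ) → (Fin N → ℕ) → (Fin N → ℤ)
lOf u0 e i = + e i ℤ.- + u0 i

InN'ᵇ : {n N : ℕ} (p : ℕ) → Prime p → (Fin N → Vec ℤ n) → Vec ℤ n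
      → (u0 e : Fin N → ℕ) → Bool
InN'ᵇ p pr a γ u0 e =
  InLᵇ a (lOf u0 e)
  ∧ ⌊ ≡-dec BoolP._≟_ (nsupp (qadd v (lOf u0 e))) (nsupp v) ⌋
  ∧ InUp1ᵇ p a γ e
  where v = vzeroOf p pr u0

-- The polynomial G_{v^(0)}(λ) ∈ ℚ(π)[λ], given by its coefficient
-- function on exponents e ∈ ℕ^N: the coefficient of λ^e is
--   [v]_{l_-}/[v+l]_{l_+} · π^{Σ e_i}   if l = e - u^(0) ∈ N'_v,  and 0 otherwise.
coeffG : {n N : ℕ} (p : ℕ) → Prime p → (Fin N → Vec ℤ n) → Vec ℤ n
       → (u0 : Fin N → ℕ) → (e : Fin N → ℕ) → Qπ p
coeffG p pr a γ u0 e =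
  if InN'ᵇ p pr a γ u0 e
  then monoπ p pr (divℚ (bracketMinus v l) (bracketPlus v l)) (+ weight e)
  else zeroπ p
  where
  v = vzeroOf p pr u0
  l = lOf u0 e

coeffπwG : {n N : ℕ} (p : ℕ) → Prime p → (Fin N → Vec ℤ n) → Vec ℤ n → ℕ
         → (u0 : Fin N → ℕ) → (e : Fin N → ℕ) → Qπ p
coeffπwG p pr a γ w u0 e = mulπpow p pr (ℤ.- (+ w)) (coeffG p pr a γ u0 e)

-- F_γ(λ) = Σ_{u ∈ U^+_min(γ)} λ^u / u!.  Its coefficients 1/u! (u_i ≤ p-1)
-- lie in ℤ_(p); we record the canonical lift to ℤ_(p) ⊂ ℚ, whose reduction
-- mod p is the coefficient in F_p.
coeffF : {n N : ℕ} → (Fin N → Vec ℤ n) → Vec ℤ n → ℕ → (e : Fin N → ℕ) → ℚ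
coeffF a γ w e =
  if InUminᵇ a γ w e
  then prodℚ (λ i → ℚ._/_ (+ 1) (e i !) {{e i !≢0}})
  else 0ℚ

factProd : {N : ℕ} → (Fin N → ℕ) → ℚ
factProd u = prodℚ (λ i → + (u i !) ℚ./ 1)

-- Write p = 2 + k and v = v⁽⁰⁾ = −u⁽⁰⁾/(p − 1). Then v − u⁽⁰⁾ = p·v, so v ≡ u⁽⁰⁾ (mod p) in ℤ₍ₚ₎.
-- Falling and rising factorials respect this congruence, and when every e_i ≤ p − 1 each factor
-- v_i + j of [v + l]_{l₊} is congruent to u⁽⁰⁾_i + j ∈ [1, p − 1], hence a unit. So for e = u⁽⁰⁾ + l
-- the rational c = [v]_{l₋}/[v + l]_{l₊} is p-integral and congruent to [u⁽⁰⁾]_{l₋}/[u⁽⁰⁾ + l]_{l₊},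
-- which equals u⁽⁰⁾!/e!. The coefficient of λ^e in π^{−w} G is c·π^{|e| − w} with |e| ≥ w: it lies in
-- π ℤ₍ₚ₎[π] unless |e| = w, i.e. e ∈ U⁺_min(γ), and then c − u⁽⁰⁾!/e! ∈ p ℤ₍ₚ₎ = π^{p−1} ℤ₍ₚ₎[π].
-- Conversely every e ∈ U⁺_min(γ) is in U⁺_{p−1}(γ) by goodness, and for such e the negative supports
-- of v and v + l agree automatically.

module Submission where

open import Data.Bool using (true; false; if_then_else_; _∧_; not; T)
import Data.Bool.Properties as BoolP
open import Data.Empty using (⊥; ⊥-elim)
open import Data.Fin using (Fin; toℕ; fromℕ<) renaming (zero to fzero; suc to fsuc)
open import Data.Fin.Properties as FinP using (all?)
open import Data.Integer as ℤ using (ℤ; +_; -[1+_])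
import Data.Integer.DivMod as ℤDM
import Data.Integer.Divisibility.Signed as ℤD
import Data.Integer.Properties as ℤP
import Data.Integer.Tactic.RingSolver as ℤSolver
open import Data.Nat as ℕ using (ℕ; zero; suc; NonZero; _≤_; _<_; s≤s; _!)
import Data.Nat.Coprimality as Coprime
open import Data.Nat.Divisibility as ℕD using (divides)
import Data.Nat.GCD as ℕG
open import Data.Nat.Primality using (Prime; euclidsLemma; prime⇒nonZero; ¬prime[0]; ¬prime[1])
import Data.Nat.Properties as ℕP
open import Data.Product using (_×_; _,_; proj₁; proj₂)
open import Data.Rational as ℚ using (ℚ; 0ℚ; 1ℚ; mkℚ; _*_)
import Data.Rational.Properties as ℚP
open import Data.Rational.Unnormalised as ℚᵘ using (mkℚᵘ; *≡*)
import Data.Rational.Unnormalised.Properties as ℚᵘP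
open import Data.Sum using (inj₁; inj₂)
open import Data.Vec using (Vec; []; _∷_; zipWith; map)
import Data.Vec.Properties as VecP
open import Function using (_∘_)
open import Level using (0ℓ)
open import Relation.Binary.PropositionalEquality
open import Relation.Nullary using (¬_; Dec; yes; no)
open import Relation.Nullary.Decidable using (dec⇒maybe; ⌊_⌋; isYes≗does; T?; toWitness; fromWitness; _×-dec_)
open import Tactic.RingSolver using (solve-∀)
import Tactic.RingSolver.Core.AlmostCommutativeRing as ACR

open import Defs

open ≡-Reasoning

ℚ-ring : ACR.AlmostCommutativeRing 0ℓ 0ℓ
ℚ-ring = ACR.fromCommutativeRing ℚP.+-*-commutativeRing (λ x → dec⇒maybe (0ℚ ℚP.≟ x))

*-interchange : ∀ a b c d → (a * b) * (c * d) ≡ (a * c) * (b * d)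
*-interchange = solve-∀ ℚ-ring

fromℤ : ℤ → ℚ
fromℤ z = z ℚ./ 1

fromℕ : ℕ → ℚ
fromℕ n = fromℤ (+ n)

infix 7.5 _/1+_
_/1+_ : ℤ → ℕ → ℚ
a /1+ b = a ℚ./ suc b

toℚᵘ-/1+ : ∀ a b → ℚ.toℚᵘ (a /1+ b) ℚᵘ.≃ mkℚᵘ a b
toℚᵘ-/1+ a b = ℚP.toℚᵘ-fromℚᵘ (mkℚᵘ a b)

/1+-cong : ∀ {a b c d} → a ℤ.* + suc d ≡ c ℤ.* + suc b → a /1+ b ≡ c /1+ d
/1+-cong {a} {b} {c} {d} eq = ℚP.fromℚᵘ-cong {mkℚᵘ a b} {mkℚᵘ c d} (*≡* eq)

/1+-* : ∀ a b c d → a /1+ b * c /1+ d ≡ (a ℤ.* c) /1+ (d ℕ.+ b ℕ.* suc d)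
/1+-* a b c d = ℚP.toℚᵘ-injective (ℚᵘP.≃-trans (ℚP.toℚᵘ-homo-* (a /1+ b) (c /1+ d))
  (ℚᵘP.≃-trans (ℚᵘP.*-cong (toℚᵘ-/1+ a b) (toℚᵘ-/1+ c d)) (ℚᵘP.≃-sym (toℚᵘ-/1+ _ _))))

/1+-+ : ∀ a b c d → a /1+ b ℚ.+ c /1+ d ≡ (a ℤ.* + suc d ℤ.+ c ℤ.* + suc b) /1+ (d ℕ.+ b ℕ.* suc d)
/1+-+ a b c d = ℚP.toℚᵘ-injective (ℚᵘP.≃-trans (ℚP.toℚᵘ-homo-+ (a /1+ b) (c /1+ d))
  (ℚᵘP.≃-trans (ℚᵘP.+-cong (toℚᵘ-/1+ a b) (toℚᵘ-/1+ c d)) (ℚᵘP.≃-sym (toℚᵘ-/1+ _ _))))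

neg-/1+ : ∀ a b → ℚ.- (a /1+ b) ≡ (ℤ.- a) /1+ b
neg-/1+ a b = ℚP.toℚᵘ-injective (ℚᵘP.≃-trans (ℚP.toℚᵘ-homo‿- (a /1+ b))
  (ℚᵘP.≃-trans (ℚᵘP.-‿cong (toℚᵘ-/1+ a b)) (ℚᵘP.≃-sym (toℚᵘ-/1+ _ _))))

fromℤ-*-/1+ : ∀ c a b → fromℤ c * a /1+ b ≡ (c ℤ.* a) /1+ b
fromℤ-*-/1+ c a b = trans (/1+-* c 0 a b) (cong ((c ℤ.* a) /1+_) (ℕP.+-identityʳ b))

/1+-+-fromℤ : ∀ a b c → a /1+ b ℚ.+ fromℤ c ≡ (a ℤ.+ c ℤ.* + suc b) /1+ b
/1+-+-fromℤ a b c = trans (/1+-+ a b c 0)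
  (cong₂ (λ x y → (x ℤ.+ c ℤ.* + suc b) /1+ y) (ℤP.*-identityʳ a) (ℕP.*-identityʳ b))

/1+-*-flip : ∀ t b → + suc t /1+ b * + suc b /1+ t ≡ 1ℚ
/1+-*-flip t b = trans (/1+-* (+ suc t) b (+ suc b) t)
  (/1+-cong {+ suc t ℤ.* + suc b} {t ℕ.+ b ℕ.* suc t} {+ 1} {0}
    (trans (swap (+ suc t) (+ suc b)) (cong (+ 1 ℤ.*_) (sym (ℤP.pos-* (suc b) (suc t))))))
  where
  swap : ∀ x y → (x ℤ.* y) ℤ.* + 1 ≡ + 1 ℤ.* (y ℤ.* x)
  swap = ℤSolver.solve-∀

/-pred : ∀ a n .{{_ : NonZero n}} → a ℚ./ n ≡ a /1+ ℕ.pred n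
/-pred a (suc n) = refl

/1+-*-fromℤ : ∀ a b c → a /1+ b * fromℤ c ≡ (a ℤ.* c) /1+ b
/1+-*-fromℤ a b c = trans (ℚP.*-comm (a /1+ b) (fromℤ c))
  (trans (fromℤ-*-/1+ c a b) (cong (_/1+ b) (ℤP.*-comm c a)))

fromℤ-* : ∀ a c → fromℤ (a ℤ.* c) ≡ fromℤ a * fromℤ c
fromℤ-* a c = sym (/1+-* a 0 c 0)

fromℤ-+ : ∀ a c → fromℤ (a ℤ.+ c) ≡ fromℤ a ℚ.+ fromℤ c
fromℤ-+ a c = sym (trans (/1+-+ a 0 c 0)
  (cong₂ (λ x y → (x ℤ.+ y) /1+ 0) (ℤP.*-identityʳ a) (ℤP.*-identityʳ c)))

fromℤ-neg : ∀ a → fromℤ (ℤ.- a) ≡ ℚ.- fromℤ a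
fromℤ-neg a = sym (neg-/1+ a 0)

fromℤ-− : ∀ a c → fromℤ (a ℤ.- c) ≡ fromℤ a ℚ.- fromℤ c
fromℤ-− a c = trans (fromℤ-+ a (ℤ.- c)) (cong (fromℤ a ℚ.+_) (fromℤ-neg c))

fromℕ-* : ∀ m n → fromℕ (m ℕ.* n) ≡ fromℕ m * fromℕ n
fromℕ-* m n = trans (cong fromℤ (ℤP.pos-* m n)) (fromℤ-* (+ m) (+ n))

fromℕ-+ : ∀ m n → fromℕ (m ℕ.+ n) ≡ fromℕ m ℚ.+ fromℕ n
fromℕ-+ m n = trans (cong fromℤ (ℤP.pos-+ m n)) (fromℤ-+ (+ m) (+ n))

fromℕ-∸ : ∀ {m n} → m ≤ n → fromℕ (n ℕ.∸ m) ≡ fromℕ n ℚ.- fromℕ m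
fromℕ-∸ {m} {n} m≤n = trans (cong fromℤ (sym (trans (ℤP.m-n≡m⊖n n m) (ℤP.⊖-≥ m≤n))))
  (fromℤ-− (+ n) (+ m))

fromℕ-*-inverse : ∀ n .{{_ : NonZero n}} → fromℕ n * (+ 1 ℚ./ n) ≡ 1ℚ
fromℕ-*-inverse (suc n) = /1+-*-flip n 0

divℚ-by-inverse : ∀ {z x y} → x * y ≡ 1ℚ → divℚ z x ≡ z * y
divℚ-by-inverse {z} {x} {y} xy≡1 with x ℚP.≟ 0ℚ
... | yes refl = ⊥-elim (ℚP.1≢0 (trans (sym xy≡1) (ℚP.*-zeroˡ y)))
... | no x≢0 = cong (z *_) (begin
  ℚ.1/ x                 ≡⟨ sym (ℚP.*-identityʳ _) ⟩
  ℚ.1/ x * 1ℚ            ≡⟨ cong (ℚ.1/ x *_) (sym xy≡1) ⟩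
  ℚ.1/ x * (x * y)       ≡⟨ sym (ℚP.*-assoc (ℚ.1/ x) x y) ⟩
  (ℚ.1/ x * x) * y       ≡⟨ cong (_* y) (ℚP.*-inverseˡ x) ⟩
  1ℚ * y                 ≡⟨ ℚP.*-identityˡ y ⟩
  y                      ∎)
  where instance _ = ℚ.≢-nonZero x≢0

prodℚ-cong : ∀ {N} {g h : Fin N → ℚ} → (∀ i → g i ≡ h i) → prodℚ g ≡ prodℚ h
prodℚ-cong {zero} eq = refl
prodℚ-cong {suc N} eq = cong₂ _*_ (eq fzero) (prodℚ-cong (eq ∘ fsuc))

prodℚ-*-distrib : ∀ {N} (g h : Fin N → ℚ) → prodℚ g * prodℚ h ≡ prodℚ (λ i → g i * h i)
prodℚ-*-distrib {zero} g h = refl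
prodℚ-*-distrib {suc N} g h =
  trans (*-interchange (g fzero) (prodℚ (g ∘ fsuc)) (h fzero) (prodℚ (h ∘ fsuc)))
        (cong (g fzero * h fzero *_) (prodℚ-*-distrib (g ∘ fsuc) (h ∘ fsuc)))

prodℚ-≡1 : ∀ {N} (g : Fin N → ℚ) → (∀ i → g i ≡ 1ℚ) → prodℚ g ≡ 1ℚ
prodℚ-≡1 {zero} g eq = refl
prodℚ-≡1 {suc N} g eq = cong₂ _*_ (eq fzero) (prodℚ-≡1 (g ∘ fsuc) (eq ∘ fsuc))

sumℚ : ∀ {N} → (Fin N → ℚ) → ℚ
sumℚ = foldFin 0ℚ ℚ._+_

sumℚ-zero : ∀ {N} (f : Fin N → ℚ) → (∀ i → f i ≡ 0ℚ) → sumℚ f ≡ 0ℚ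
sumℚ-zero {zero} f _ = refl
sumℚ-zero {suc N} f f≡0 = cong₂ ℚ._+_ (f≡0 fzero) (sumℚ-zero (f ∘ fsuc) (f≡0 ∘ fsuc))

sumℚ-single : ∀ {N} (f : Fin N → ℚ) {r} (r<N : r < N) → (∀ i → toℕ i ≢ r → f i ≡ 0ℚ) → sumℚ f ≡ f (fromℕ< r<N)
sumℚ-single {suc N} f {zero} _ f≡0 =
  trans (cong (f fzero ℚ.+_) (sumℚ-zero (f ∘ fsuc) (λ i → f≡0 (fsuc i) λ ()))) (ℚP.+-identityʳ (f fzero))
sumℚ-single {suc N} f {suc r} (s≤s r<N) f≡0 =
  trans (cong (ℚ._+ sumℚ (f ∘ fsuc)) (f≡0 fzero λ ()))
    (trans (ℚP.+-identityˡ _) (sumℚ-single (f ∘ fsuc) r<N (λ i i≢r → f≡0 (fsuc i) (i≢r ∘ ℕP.suc-injective))))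

*-!-pred : ∀ {n k} → n ≡ suc k → n ℕ.* k ! ≡ n !
*-!-pred refl = refl

falling-fromℕ : ∀ u m → m ≤ u → falling (fromℕ u) m * fromℕ ((u ℕ.∸ m) !) ≡ fromℕ (u !)
falling-fromℕ u zero _ = ℚP.*-identityˡ _
falling-fromℕ u (suc m) m<u = begin
  falling (fromℕ u) m * (fromℕ u ℚ.- fromℕ m) * fromℕ ((u ℕ.∸ suc m) !)
    ≡⟨ ℚP.*-assoc (falling (fromℕ u) m) _ _ ⟩
  falling (fromℕ u) m * ((fromℕ u ℚ.- fromℕ m) * fromℕ ((u ℕ.∸ suc m) !))
    ≡⟨ cong (λ t → falling (fromℕ u) m * (t * fromℕ ((u ℕ.∸ suc m) !))) (sym (fromℕ-∸ m≤u)) ⟩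
  falling (fromℕ u) m * (fromℕ (u ℕ.∸ m) * fromℕ ((u ℕ.∸ suc m) !))
    ≡⟨ cong (falling (fromℕ u) m *_) (sym (fromℕ-* (u ℕ.∸ m) _)) ⟩
  falling (fromℕ u) m * fromℕ ((u ℕ.∸ m) ℕ.* (u ℕ.∸ suc m) !)
    ≡⟨ cong (λ t → falling (fromℕ u) m * fromℕ t) (*-!-pred (ℕP.+-∸-assoc 1 m<u)) ⟩
  falling (fromℕ u) m * fromℕ ((u ℕ.∸ m) !)
    ≡⟨ falling-fromℕ u m m≤u ⟩
  fromℕ (u !) ∎
  where
  m≤u : m ≤ u
  m≤u = ℕP.<⇒≤ m<u

rising-fromℕ : ∀ u m → rising (fromℕ u) m * fromℕ (u !) ≡ fromℕ ((u ℕ.+ m) !)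
rising-fromℕ u zero = trans (ℚP.*-identityˡ _) (cong (λ t → fromℕ (t !)) (sym (ℕP.+-identityʳ u)))
rising-fromℕ u (suc m) = begin
  rising (fromℕ u) m * (fromℕ u ℚ.+ fromℕ (suc m)) * fromℕ (u !)
    ≡⟨ cong (λ t → rising (fromℕ u) m * t * fromℕ (u !)) (sym (fromℕ-+ u (suc m))) ⟩
  rising (fromℕ u) m * fromℕ (u ℕ.+ suc m) * fromℕ (u !)
    ≡⟨ rotate (rising (fromℕ u) m) _ _ ⟩
  fromℕ (u ℕ.+ suc m) * (rising (fromℕ u) m * fromℕ (u !))
    ≡⟨ cong (fromℕ (u ℕ.+ suc m) *_) (rising-fromℕ u m) ⟩
  fromℕ (u ℕ.+ suc m) * fromℕ ((u ℕ.+ m) !)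
    ≡⟨ sym (fromℕ-* (u ℕ.+ suc m) _) ⟩
  fromℕ ((u ℕ.+ suc m) ℕ.* (u ℕ.+ m) !)
    ≡⟨ cong fromℕ (*-!-pred (ℕP.+-suc u m)) ⟩
  fromℕ ((u ℕ.+ suc m) !) ∎
  where
  rotate : ∀ a b c → a * b * c ≡ b * (a * c)
  rotate = solve-∀ ℚ-ring

falling⁻ : ℚ → ℤ → ℚ
falling⁻ x (+ _)    = 1ℚ
falling⁻ x -[1+ m ] = falling x (suc m)

rising⁺ : ℚ → ℤ → ℚ
rising⁺ x (+ m)    = rising x m
rising⁺ x -[1+ _ ] = 1ℚ

bracketMinus-prod : ∀ {N} (v : Fin N → ℚ) l → bracketMinus v l ≡ prodℚ (λ i → falling⁻ (v i) (l i))
bracketMinus-prod {zero} v l = refl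
bracketMinus-prod {suc N} v l with l fzero
... | + _      = cong (1ℚ *_) (bracketMinus-prod (v ∘ fsuc) (l ∘ fsuc))
... | -[1+ m ] = cong (falling (v fzero) (suc m) *_) (bracketMinus-prod (v ∘ fsuc) (l ∘ fsuc))

bracketPlus-prod : ∀ {N} (v : Fin N → ℚ) l → bracketPlus v l ≡ prodℚ (λ i → rising⁺ (v i) (l i))
bracketPlus-prod {zero} v l = refl
bracketPlus-prod {suc N} v l with l fzero
... | + m      = cong (rising (v fzero) m *_) (bracketPlus-prod (v ∘ fsuc) (l ∘ fsuc))
... | -[1+ _ ] = cong (1ℚ *_) (bracketPlus-prod (v ∘ fsuc) (l ∘ fsuc))

m-n≡+k⇒m≡n+k : ∀ {m n k} → + m ℤ.- + n ≡ + k → m ≡ n ℕ.+ k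
m-n≡+k⇒m≡n+k {m} {n} {k} eq = ℤP.+-injective (begin
  + m                     ≡⟨ sym (cancel (+ m) (+ n)) ⟩
  (+ m ℤ.- + n) ℤ.+ + n   ≡⟨ cong (ℤ._+ + n) eq ⟩
  + k ℤ.+ + n             ≡⟨ ℤP.+-comm (+ k) (+ n) ⟩
  + (n ℕ.+ k)             ∎)
  where
  cancel : ∀ a b → (a ℤ.- b) ℤ.+ b ≡ a
  cancel = ℤSolver.solve-∀

m-n≡-[1+k]⇒n≡m+1+k : ∀ {m n k} → + m ℤ.- + n ≡ -[1+ k ] → n ≡ m ℕ.+ suc k
m-n≡-[1+k]⇒n≡m+1+k {m} {n} {k} eq = ℤP.+-injective (begin
  + n                       ≡⟨ sym (cancel (+ m) (+ n)) ⟩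
  + m ℤ.- (+ m ℤ.- + n)     ≡⟨ cong (λ t → + m ℤ.- t) eq ⟩
  + (m ℕ.+ suc k)           ∎)
  where
  cancel : ∀ a b → a ℤ.- (a ℤ.- b) ≡ b
  cancel = ℤSolver.solve-∀

falling⁻-rising⁺-fromℕ : ∀ u e →
  falling⁻ (fromℕ u) (+ e ℤ.- + u) * fromℕ (e !) ≡ rising⁺ (fromℕ u) (+ e ℤ.- + u) * fromℕ (u !)
falling⁻-rising⁺-fromℕ u e = by-difference (+ e ℤ.- + u) refl
  where
  by-difference : ∀ z → + e ℤ.- + u ≡ z → falling⁻ (fromℕ u) z * fromℕ (e !) ≡ rising⁺ (fromℕ u) z * fromℕ (u !)
  by-difference (+ m) eq = begin
    1ℚ * fromℕ (e !)             ≡⟨ ℚP.*-identityˡ _ ⟩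
    fromℕ (e !)                  ≡⟨ cong (λ t → fromℕ (t !)) (m-n≡+k⇒m≡n+k {e} {u} {m} eq) ⟩
    fromℕ ((u ℕ.+ m) !)          ≡⟨ sym (rising-fromℕ u m) ⟩
    rising (fromℕ u) m * fromℕ (u !) ∎
  by-difference -[1+ m ] eq = begin
    falling (fromℕ u) (suc m) * fromℕ (e !)               ≡⟨ cong (λ t → falling (fromℕ u) (suc m) * fromℕ (t !)) (sym u∸1+m≡e) ⟩
    falling (fromℕ u) (suc m) * fromℕ ((u ℕ.∸ suc m) !)   ≡⟨ falling-fromℕ u (suc m) 1+m≤u ⟩
    fromℕ (u !)                                           ≡⟨ sym (ℚP.*-identityˡ _) ⟩
    1ℚ * fromℕ (u !)                                      ∎
    where
    u≡e+1+m : u ≡ e ℕ.+ suc m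
    u≡e+1+m = m-n≡-[1+k]⇒n≡m+1+k {e} {u} {m} eq
    u∸1+m≡e : u ℕ.∸ suc m ≡ e
    u∸1+m≡e = trans (cong (ℕ._∸ suc m) u≡e+1+m) (ℕP.m+n∸n≡m e (suc m))
    1+m≤u : suc m ≤ u
    1+m≤u = subst (suc m ≤_) (sym u≡e+1+m) (ℕP.m≤n+m (suc m) e)

bracket-identity-fromℕ : ∀ {N} (u e : Fin N → ℕ) →
  bracketMinus (fromℕ ∘ u) (lOf u e) * prodℚ (λ i → fromℕ (e i !))
    ≡ bracketPlus (fromℕ ∘ u) (lOf u e) * factProd u
bracket-identity-fromℕ u e = begin
  bracketMinus (fromℕ ∘ u) l * prodℚ (λ i → fromℕ (e i !))
    ≡⟨ cong (_* prodℚ (λ i → fromℕ (e i !))) (bracketMinus-prod (fromℕ ∘ u) l) ⟩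
  prodℚ (λ i → falling⁻ (fromℕ (u i)) (l i)) * prodℚ (λ i → fromℕ (e i !))
    ≡⟨ prodℚ-*-distrib (λ i → falling⁻ (fromℕ (u i)) (l i)) (λ i → fromℕ (e i !)) ⟩
  prodℚ (λ i → falling⁻ (fromℕ (u i)) (l i) * fromℕ (e i !))
    ≡⟨ prodℚ-cong (λ i → falling⁻-rising⁺-fromℕ (u i) (e i)) ⟩
  prodℚ (λ i → rising⁺ (fromℕ (u i)) (l i) * fromℕ (u i !))
    ≡⟨ sym (prodℚ-*-distrib (λ i → rising⁺ (fromℕ (u i)) (l i)) (λ i → fromℕ (u i !))) ⟩
  prodℚ (λ i → rising⁺ (fromℕ (u i)) (l i)) * factProd u
    ≡⟨ cong (_* factProd u) (sym (bracketPlus-prod (fromℕ ∘ u) l)) ⟩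
  bracketPlus (fromℕ ∘ u) l * factProd u ∎
  where l = lOf u e

invFactorial : ℕ → ℚ
invFactorial n = (+ 1 ℚ./ (n !)) {{n ℕP.!≢0}}

bracket-quotient-fromℕ : ∀ {N} (u e : Fin N → ℕ) {y} →
  bracketPlus (fromℕ ∘ u) (lOf u e) * y ≡ 1ℚ →
  bracketMinus (fromℕ ∘ u) (lOf u e) * y ≡ factProd u * prodℚ (invFactorial ∘ e)
bracket-quotient-fromℕ u e {y} B⁺y≡1 = begin
  B⁻ * y                      ≡⟨ sym (ℚP.*-identityʳ _) ⟩
  B⁻ * y * 1ℚ                 ≡⟨ cong (B⁻ * y *_) (sym E*E⁻¹≡1) ⟩
  B⁻ * y * (E * E⁻¹)          ≡⟨ *-interchange B⁻ y E E⁻¹ ⟩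
  B⁻ * E * (y * E⁻¹)          ≡⟨ cong (_* (y * E⁻¹)) (bracket-identity-fromℕ u e) ⟩
  B⁺ * factProd u * (y * E⁻¹) ≡⟨ *-interchange B⁺ (factProd u) y E⁻¹ ⟩
  B⁺ * y * (factProd u * E⁻¹) ≡⟨ cong (_* (factProd u * E⁻¹)) B⁺y≡1 ⟩
  1ℚ * (factProd u * E⁻¹)     ≡⟨ ℚP.*-identityˡ _ ⟩
  factProd u * E⁻¹            ∎
  where
  B⁻ = bracketMinus (fromℕ ∘ u) (lOf u e)
  B⁺ = bracketPlus (fromℕ ∘ u) (lOf u e)
  E = prodℚ (λ i → fromℕ (e i !))
  E⁻¹ = prodℚ (invFactorial ∘ e)
  E*E⁻¹≡1 : E * E⁻¹ ≡ 1ℚ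
  E*E⁻¹≡1 = trans (prodℚ-*-distrib (λ i → fromℕ (e i !)) (invFactorial ∘ e))
    (prodℚ-≡1 _ (λ i → fromℕ-*-inverse (e i !) {{e i ℕP.!≢0}}))

-- The local ring ℤ₍ₚ₎

module Localisation {p : ℕ} (pr : Prime p) where

  p∤1 : ¬ p ℕD.∣ 1
  p∤1 p∣1 = ¬prime[1] (subst Prime (ℕD.∣1⇒≡1 p∣1) pr)

  p∤* : ∀ {m n} → ¬ p ℕD.∣ m → ¬ p ℕD.∣ n → ¬ p ℕD.∣ m ℕ.* n
  p∤* {m} {n} p∤m p∤n p∣mn with euclidsLemma m n pr p∣mn
  ... | inj₁ p∣m = p∤m p∣m
  ... | inj₂ p∣n = p∤n p∣n

  p∤-< : ∀ {n} → 0 < n → n < p → ¬ p ℕD.∣ n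
  p∤-< {suc n} _ n<p p∣n = ℕP.<⇒≱ n<p (ℕD.∣⇒≤ p∣n)

  -- witnessed by any fraction, not necessarily reduced, whose denominator is prime to p
  record ℤ₍ₚ₎ (x : ℚ) : Set where
    constructor representation
    field
      numerator      : ℤ
      denominator-1  : ℕ
      p∤denominator  : ¬ p ℕD.∣ suc denominator-1
      ≡representation : x ≡ numerator /1+ denominator-1

  ℤ₍ₚ₎-fromℤ : ∀ a → ℤ₍ₚ₎ (fromℤ a)
  ℤ₍ₚ₎-fromℤ a = representation a 0 p∤1 refl

  ℤ₍ₚ₎-1 : ℤ₍ₚ₎ 1ℚ
  ℤ₍ₚ₎-1 = ℤ₍ₚ₎-fromℤ (+ 1)

  ℤ₍ₚ₎-* : ∀ {x y} → ℤ₍ₚ₎ x → ℤ₍ₚ₎ y → ℤ₍ₚ₎ (x * y)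
  ℤ₍ₚ₎-* (representation a b p∤b x≡) (representation c d p∤d y≡) =
    representation (a ℤ.* c) (d ℕ.+ b ℕ.* suc d) (p∤* p∤b p∤d) (trans (cong₂ _*_ x≡ y≡) (/1+-* a b c d))

  ℤ₍ₚ₎-+ : ∀ {x y} → ℤ₍ₚ₎ x → ℤ₍ₚ₎ y → ℤ₍ₚ₎ (x ℚ.+ y)
  ℤ₍ₚ₎-+ (representation a b p∤b x≡) (representation c d p∤d y≡) =
    representation (a ℤ.* + suc d ℤ.+ c ℤ.* + suc b) (d ℕ.+ b ℕ.* suc d) (p∤* p∤b p∤d)
      (trans (cong₂ ℚ._+_ x≡ y≡) (/1+-+ a b c d))

  ℤ₍ₚ₎-neg : ∀ {x} → ℤ₍ₚ₎ x → ℤ₍ₚ₎ (ℚ.- x)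
  ℤ₍ₚ₎-neg (representation a b p∤b x≡) =
    representation (ℤ.- a) b p∤b (trans (cong ℚ.-_ x≡) (neg-/1+ a b))

  ℤ₍ₚ₎-− : ∀ {x y} → ℤ₍ₚ₎ x → ℤ₍ₚ₎ y → ℤ₍ₚ₎ (x ℚ.- y)
  ℤ₍ₚ₎-− x∈ y∈ = ℤ₍ₚ₎-+ x∈ (ℤ₍ₚ₎-neg y∈)

  ℤ₍ₚ₎⇒IntZp : ∀ {x} → ℤ₍ₚ₎ x → IntZp p x
  ℤ₍ₚ₎⇒IntZp {mkℚ n d-1 coprime} (representation a b p∤b x≡) p∣d = p∤b (ℕD.∣-trans p∣d d∣b)
    where
    n*b≡a*d : n ℤ.* + suc b ≡ a ℤ.* + suc d-1
    n*b≡a*d with ℚᵘP.≃-trans (ℚP.toℚᵘ-cong x≡) (toℚᵘ-/1+ a b)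
    ... | *≡* eq = eq
    d∣b : suc d-1 ℕD.∣ suc b
    d∣b = Coprime.coprime-divisor (Coprime.sym (Coprime.recompute coprime)) (divides ℤ.∣ a ∣
      (trans (sym (ℤP.abs-* n (+ suc b))) (trans (cong ℤ.∣_∣ n*b≡a*d) (ℤP.abs-* a (+ suc d-1)))))

  record pℤ₍ₚ₎ (x : ℚ) : Set where
    constructor p*_∣_,_
    field
      cofactor   : ℚ
      cofactor∈  : ℤ₍ₚ₎ cofactor
      ≡p*cofactor : x ≡ fromℕ p * cofactor

  pℤ₍ₚ₎-0 : pℤ₍ₚ₎ 0ℚ
  pℤ₍ₚ₎-0 = p* 0ℚ ∣ ℤ₍ₚ₎-fromℤ (+ 0) , sym (ℚP.*-zeroʳ (fromℕ p))

  pℤ₍ₚ₎-+ : ∀ {x y} → pℤ₍ₚ₎ x → pℤ₍ₚ₎ y → pℤ₍ₚ₎ (x ℚ.+ y)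
  pℤ₍ₚ₎-+ (p* a ∣ a∈ , x≡) (p* b ∣ b∈ , y≡) =
    p* a ℚ.+ b ∣ ℤ₍ₚ₎-+ a∈ b∈ , trans (cong₂ ℚ._+_ x≡ y≡) (sym (ℚP.*-distribˡ-+ (fromℕ p) a b))

  pℤ₍ₚ₎-neg : ∀ {x} → pℤ₍ₚ₎ x → pℤ₍ₚ₎ (ℚ.- x)
  pℤ₍ₚ₎-neg (p* a ∣ a∈ , x≡) =
    p* ℚ.- a ∣ ℤ₍ₚ₎-neg a∈ , trans (cong ℚ.-_ x≡) (ℚP.neg-distribʳ-* (fromℕ p) a)

  pℤ₍ₚ₎-* : ∀ {x y} → pℤ₍ₚ₎ x → ℤ₍ₚ₎ y → pℤ₍ₚ₎ (x * y)
  pℤ₍ₚ₎-* {y = y} (p* a ∣ a∈ , x≡) y∈ =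
    p* a * y ∣ ℤ₍ₚ₎-* a∈ y∈ , trans (cong (_* y) x≡) (ℚP.*-assoc (fromℕ p) a y)

  infix 4 _≡ₚ_
  record _≡ₚ_ (x y : ℚ) : Set where
    constructor mod-p
    field
      difference : pℤ₍ₚ₎ (x ℚ.- y)

  ≡ₚ-reflexive : ∀ {x y} → x ≡ y → x ≡ₚ y
  ≡ₚ-reflexive {x} refl = mod-p (subst pℤ₍ₚ₎ (sym (ℚP.+-inverseʳ x)) pℤ₍ₚ₎-0)

  ≡ₚ-refl : ∀ {x} → x ≡ₚ x
  ≡ₚ-refl = ≡ₚ-reflexive refl

  ≡ₚ-sym : ∀ {x y} → x ≡ₚ y → y ≡ₚ x
  ≡ₚ-sym {x} {y} (mod-p x-y) = mod-p (subst pℤ₍ₚ₎ (negate x y) (pℤ₍ₚ₎-neg x-y))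
    where
    negate : ∀ x y → ℚ.- (x ℚ.- y) ≡ y ℚ.- x
    negate = solve-∀ ℚ-ring

  ≡ₚ-+ : ∀ {x x′ y y′} → x ≡ₚ x′ → y ≡ₚ y′ → x ℚ.+ y ≡ₚ x′ ℚ.+ y′
  ≡ₚ-+ {x} {x′} {y} {y′} (mod-p x-x′) (mod-p y-y′) =
    mod-p (subst pℤ₍ₚ₎ (regroup x x′ y y′) (pℤ₍ₚ₎-+ x-x′ y-y′))
    where
    regroup : ∀ x x′ y y′ → (x ℚ.- x′) ℚ.+ (y ℚ.- y′) ≡ (x ℚ.+ y) ℚ.- (x′ ℚ.+ y′)
    regroup = solve-∀ ℚ-ring

  ≡ₚ-* : ∀ {x x′ y y′} → ℤ₍ₚ₎ x′ → ℤ₍ₚ₎ y → x ≡ₚ x′ → y ≡ₚ y′ → x * y ≡ₚ x′ * y′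
  ≡ₚ-* {x} {x′} {y} {y′} x′∈ y∈ (mod-p x-x′) (mod-p y-y′) =
    mod-p (subst pℤ₍ₚ₎ (regroup x x′ y y′) (pℤ₍ₚ₎-+ (pℤ₍ₚ₎-* x-x′ y∈) (pℤ₍ₚ₎-* y-y′ x′∈)))
    where
    regroup : ∀ x x′ y y′ → (x ℚ.- x′) * y ℚ.+ (y ℚ.- y′) * x′ ≡ x * y ℚ.- x′ * y′
    regroup = solve-∀ ℚ-ring

  record Invertible (x : ℚ) : Set where
    constructor inverse_∣_,_
    field
      inverse    : ℚ
      inverse∈   : ℤ₍ₚ₎ inverse
      *-inverse  : x * inverse ≡ 1ℚ

  Invertible-1 : Invertible 1ℚ
  Invertible-1 = inverse 1ℚ ∣ ℤ₍ₚ₎-1 , refl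

  Invertible-* : ∀ {x x′} → Invertible x → Invertible x′ → Invertible (x * x′)
  Invertible-* {x} {x′} (inverse y ∣ y∈ , xy≡1) (inverse y′ ∣ y′∈ , x′y′≡1) =
    inverse y * y′ ∣ ℤ₍ₚ₎-* y∈ y′∈ , trans (*-interchange x x′ y y′) (cong₂ _*_ xy≡1 x′y′≡1)

  inverse-≡ₚ : ∀ {x x′} (x⁻¹ : Invertible x) (x′⁻¹ : Invertible x′) → x ≡ₚ x′ →
               Invertible.inverse x⁻¹ ≡ₚ Invertible.inverse x′⁻¹
  inverse-≡ₚ {x} {x′} (inverse y ∣ y∈ , xy≡1) (inverse y′ ∣ y′∈ , x′y′≡1) x≡x′ =
    mod-p (subst pℤ₍ₚ₎ difference (pℤ₍ₚ₎-* (_≡ₚ_.difference (≡ₚ-sym x≡x′)) (ℤ₍ₚ₎-* y∈ y′∈)))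
    where
    expand : ∀ x x′ y y′ → (x′ ℚ.- x) * (y * y′) ≡ y * (x′ * y′) ℚ.- (x * y) * y′
    expand = solve-∀ ℚ-ring
    difference : (x′ ℚ.- x) * (y * y′) ≡ y ℚ.- y′
    difference = trans (expand x x′ y y′) (trans (cong₂ (λ a b → y * a ℚ.- b * y′) x′y′≡1 xy≡1)
      (cong₂ ℚ._-_ (ℚP.*-identityʳ y) (ℚP.*-identityˡ y′)))

  Invertible-/1+ : ∀ m b → ¬ (+ p) ℤD.∣ m → Invertible (m /1+ b)
  Invertible-/1+ (+ zero) b p∤m = ⊥-elim (p∤m (ℤD.divides (+ 0) refl))
  Invertible-/1+ (+ suc t) b p∤m =
    inverse + suc b /1+ t ∣ representation (+ suc b) t (p∤m ∘ ℤD.∣ᵤ⇒∣) refl , /1+-*-flip t b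
  Invertible-/1+ -[1+ t ] b p∤m =
    inverse ℚ.- (+ suc b /1+ t) ∣ ℤ₍ₚ₎-neg (representation (+ suc b) t (p∤m ∘ ℤD.∣ᵤ⇒∣) refl) , (begin
      -[1+ t ] /1+ b * ℚ.- (+ suc b /1+ t)        ≡⟨ cong (_* ℚ.- (+ suc b /1+ t)) (sym (neg-/1+ (+ suc t) b)) ⟩
      ℚ.- (+ suc t /1+ b) * ℚ.- (+ suc b /1+ t)   ≡⟨ neg-*-neg (+ suc t /1+ b) _ ⟩
      + suc t /1+ b * + suc b /1+ t               ≡⟨ /1+-*-flip t b ⟩
      1ℚ                                          ∎)
    where
    neg-*-neg : ∀ x y → ℚ.- x * ℚ.- y ≡ x * y
    neg-*-neg = solve-∀ ℚ-ring

  Invertible-≡ₚ : ∀ {x} n → ¬ p ℕD.∣ n → x ≡ₚ fromℕ n → Invertible x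
  Invertible-≡ₚ {x} n p∤n (mod-p (p* y ∣ representation a b p∤b y≡ , x-n≡py)) =
    subst Invertible (sym x≡m/b) (Invertible-/1+ m b p∤m)
    where
    m = + p ℤ.* a ℤ.+ + n ℤ.* + suc b
    split : ∀ x z → x ≡ (x ℚ.- z) ℚ.+ z
    split = solve-∀ ℚ-ring
    x≡m/b : x ≡ m /1+ b
    x≡m/b = begin
      x                                  ≡⟨ split x (fromℕ n) ⟩
      (x ℚ.- fromℕ n) ℚ.+ fromℕ n        ≡⟨ cong (ℚ._+ fromℕ n) (trans x-n≡py (cong (fromℕ p *_) y≡)) ⟩
      fromℕ p * a /1+ b ℚ.+ fromℕ n      ≡⟨ cong (ℚ._+ fromℕ n) (fromℤ-*-/1+ (+ p) a b) ⟩
      (+ p ℤ.* a) /1+ b ℚ.+ fromℕ n      ≡⟨ /1+-+-fromℤ (+ p ℤ.* a) b (+ n) ⟩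
      m /1+ b                            ∎
    p∤m : ¬ (+ p) ℤD.∣ m
    p∤m p∣m = p∤* p∤n p∤b (ℤD.∣⇒∣ᵤ (subst ((+ p) ℤD.∣_) (sym (ℤP.pos-* n (suc b)))
      (ℤD.∣m+n∣m⇒∣n p∣m (ℤD.∣m⇒∣m*n a ℤD.∣-refl))))

  prodℚ-ℤ₍ₚ₎ : ∀ {N} {g : Fin N → ℚ} → (∀ i → ℤ₍ₚ₎ (g i)) → ℤ₍ₚ₎ (prodℚ g)
  prodℚ-ℤ₍ₚ₎ {zero} _ = ℤ₍ₚ₎-1
  prodℚ-ℤ₍ₚ₎ {suc N} g∈ = ℤ₍ₚ₎-* (g∈ fzero) (prodℚ-ℤ₍ₚ₎ (g∈ ∘ fsuc))

  prodℚ-≡ₚ : ∀ {N} {g h : Fin N → ℚ} → (∀ i → ℤ₍ₚ₎ (g i)) → (∀ i → ℤ₍ₚ₎ (h i)) →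
             (∀ i → g i ≡ₚ h i) → prodℚ g ≡ₚ prodℚ h
  prodℚ-≡ₚ {zero} _ _ _ = ≡ₚ-refl
  prodℚ-≡ₚ {suc N} g∈ h∈ g≡h =
    ≡ₚ-* (h∈ fzero) (prodℚ-ℤ₍ₚ₎ (g∈ ∘ fsuc)) (g≡h fzero) (prodℚ-≡ₚ (g∈ ∘ fsuc) (h∈ ∘ fsuc) (g≡h ∘ fsuc))

  prodℚ-Invertible : ∀ {N} {g : Fin N → ℚ} → (∀ i → Invertible (g i)) → Invertible (prodℚ g)
  prodℚ-Invertible {zero} _ = Invertible-1
  prodℚ-Invertible {suc N} g⁻¹ = Invertible-* (g⁻¹ fzero) (prodℚ-Invertible (g⁻¹ ∘ fsuc))

  falling-ℤ₍ₚ₎ : ∀ {x} m → ℤ₍ₚ₎ x → ℤ₍ₚ₎ (falling x m)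
  falling-ℤ₍ₚ₎ zero _ = ℤ₍ₚ₎-1
  falling-ℤ₍ₚ₎ (suc m) x∈ = ℤ₍ₚ₎-* (falling-ℤ₍ₚ₎ m x∈) (ℤ₍ₚ₎-− x∈ (ℤ₍ₚ₎-fromℤ (+ m)))

  falling-≡ₚ : ∀ {x x′} m → ℤ₍ₚ₎ x → ℤ₍ₚ₎ x′ → x ≡ₚ x′ → falling x m ≡ₚ falling x′ m
  falling-≡ₚ zero _ _ _ = ≡ₚ-refl
  falling-≡ₚ (suc m) x∈ x′∈ x≡ =
    ≡ₚ-* (falling-ℤ₍ₚ₎ m x′∈) (ℤ₍ₚ₎-− x∈ (ℤ₍ₚ₎-fromℤ (+ m))) (falling-≡ₚ m x∈ x′∈ x≡) (≡ₚ-+ x≡ ≡ₚ-refl)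

  rising-ℤ₍ₚ₎ : ∀ {x} m → ℤ₍ₚ₎ x → ℤ₍ₚ₎ (rising x m)
  rising-ℤ₍ₚ₎ zero _ = ℤ₍ₚ₎-1
  rising-ℤ₍ₚ₎ (suc m) x∈ = ℤ₍ₚ₎-* (rising-ℤ₍ₚ₎ m x∈) (ℤ₍ₚ₎-+ x∈ (ℤ₍ₚ₎-fromℤ (+ suc m)))

  rising-≡ₚ : ∀ {x x′} m → ℤ₍ₚ₎ x → ℤ₍ₚ₎ x′ → x ≡ₚ x′ → rising x m ≡ₚ rising x′ m
  rising-≡ₚ zero _ _ _ = ≡ₚ-refl
  rising-≡ₚ (suc m) x∈ x′∈ x≡ =
    ≡ₚ-* (rising-ℤ₍ₚ₎ m x′∈) (ℤ₍ₚ₎-+ x∈ (ℤ₍ₚ₎-fromℤ (+ suc m))) (rising-≡ₚ m x∈ x′∈ x≡) (≡ₚ-+ x≡ ≡ₚ-refl)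

  -- each factor x + j is congruent to u + j ∈ [1, p)
  rising-Invertible : ∀ {x} u m → x ≡ₚ fromℕ u → u ℕ.+ m < p → Invertible (rising x m)
  rising-Invertible u zero _ _ = Invertible-1
  rising-Invertible {x} u (suc m) x≡u u+1+m<p =
    Invertible-* (rising-Invertible u m x≡u (ℕP.<-trans (ℕP.+-monoʳ-< u (ℕP.n<1+n m)) u+1+m<p))
      (Invertible-≡ₚ (u ℕ.+ suc m) (p∤-< (ℕP.<-≤-trans ℕ.z<s (ℕP.m≤n+m (suc m) u)) u+1+m<p)
        (subst (x ℚ.+ fromℕ (suc m) ≡ₚ_) (sym (fromℕ-+ u (suc m))) (≡ₚ-+ x≡u ≡ₚ-refl)))

  falling⁻-ℤ₍ₚ₎ : ∀ {x} z → ℤ₍ₚ₎ x → ℤ₍ₚ₎ (falling⁻ x z)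
  falling⁻-ℤ₍ₚ₎ (+ _)      _  = ℤ₍ₚ₎-1
  falling⁻-ℤ₍ₚ₎ -[1+ m ] x∈ = falling-ℤ₍ₚ₎ (suc m) x∈

  falling⁻-≡ₚ : ∀ {x x′} z → ℤ₍ₚ₎ x → ℤ₍ₚ₎ x′ → x ≡ₚ x′ → falling⁻ x z ≡ₚ falling⁻ x′ z
  falling⁻-≡ₚ (+ _)      _ _ _ = ≡ₚ-refl
  falling⁻-≡ₚ -[1+ m ] x∈ x′∈ x≡ = falling-≡ₚ (suc m) x∈ x′∈ x≡

  rising⁺-ℤ₍ₚ₎ : ∀ {x} z → ℤ₍ₚ₎ x → ℤ₍ₚ₎ (rising⁺ x z)
  rising⁺-ℤ₍ₚ₎ (+ m)    x∈ = rising-ℤ₍ₚ₎ m x∈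
  rising⁺-ℤ₍ₚ₎ -[1+ _ ] _  = ℤ₍ₚ₎-1

  rising⁺-≡ₚ : ∀ {x x′} z → ℤ₍ₚ₎ x → ℤ₍ₚ₎ x′ → x ≡ₚ x′ → rising⁺ x z ≡ₚ rising⁺ x′ z
  rising⁺-≡ₚ (+ m)    x∈ x′∈ x≡ = rising-≡ₚ m x∈ x′∈ x≡
  rising⁺-≡ₚ -[1+ _ ] _ _ _     = ≡ₚ-refl

  rising⁺-Invertible : ∀ {x} u e → x ≡ₚ fromℕ u → e < p → Invertible (rising⁺ x (+ e ℤ.- + u))
  rising⁺-Invertible {x} u e x≡u e<p = by-difference (+ e ℤ.- + u) refl
    where
    by-difference : ∀ z → + e ℤ.- + u ≡ z → Invertible (rising⁺ x z)
    by-difference (+ m)    eq = rising-Invertible u m x≡u (subst (_< p) (m-n≡+k⇒m≡n+k {e} {u} {m} eq) e<p)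
    by-difference -[1+ _ ] _  = Invertible-1

  bracketMinus-ℤ₍ₚ₎ : ∀ {N} {v : Fin N → ℚ} l → (∀ i → ℤ₍ₚ₎ (v i)) → ℤ₍ₚ₎ (bracketMinus v l)
  bracketMinus-ℤ₍ₚ₎ {v = v} l v∈ =
    subst ℤ₍ₚ₎ (sym (bracketMinus-prod v l)) (prodℚ-ℤ₍ₚ₎ (λ i → falling⁻-ℤ₍ₚ₎ (l i) (v∈ i)))

  bracketMinus-≡ₚ : ∀ {N} {v v′ : Fin N → ℚ} l → (∀ i → ℤ₍ₚ₎ (v i)) → (∀ i → ℤ₍ₚ₎ (v′ i)) →
                    (∀ i → v i ≡ₚ v′ i) → bracketMinus v l ≡ₚ bracketMinus v′ l
  bracketMinus-≡ₚ {v = v} {v′} l v∈ v′∈ v≡v′ =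
    subst₂ _≡ₚ_ (sym (bracketMinus-prod v l)) (sym (bracketMinus-prod v′ l))
      (prodℚ-≡ₚ (λ i → falling⁻-ℤ₍ₚ₎ (l i) (v∈ i)) (λ i → falling⁻-ℤ₍ₚ₎ (l i) (v′∈ i))
                (λ i → falling⁻-≡ₚ (l i) (v∈ i) (v′∈ i) (v≡v′ i)))

  bracketPlus-≡ₚ : ∀ {N} {v v′ : Fin N → ℚ} l → (∀ i → ℤ₍ₚ₎ (v i)) → (∀ i → ℤ₍ₚ₎ (v′ i)) →
                   (∀ i → v i ≡ₚ v′ i) → bracketPlus v l ≡ₚ bracketPlus v′ l
  bracketPlus-≡ₚ {v = v} {v′} l v∈ v′∈ v≡v′ =
    subst₂ _≡ₚ_ (sym (bracketPlus-prod v l)) (sym (bracketPlus-prod v′ l))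
      (prodℚ-≡ₚ (λ i → rising⁺-ℤ₍ₚ₎ (l i) (v∈ i)) (λ i → rising⁺-ℤ₍ₚ₎ (l i) (v′∈ i))
                (λ i → rising⁺-≡ₚ (l i) (v∈ i) (v′∈ i) (v≡v′ i)))

  bracketPlus-Invertible : ∀ {N} {v : Fin N → ℚ} (u e : Fin N → ℕ) → (∀ i → v i ≡ₚ fromℕ (u i)) →
                           (∀ i → e i < p) → Invertible (bracketPlus v (lOf u e))
  bracketPlus-Invertible {v = v} u e v≡u e<p = subst Invertible (sym (bracketPlus-prod v (lOf u e)))
    (prodℚ-Invertible (λ i → rising⁺-Invertible (u i) (e i) (v≡u i) (e<p i)))

pos-^ : ∀ p m → + (p ℕ.^ m) ≡ (+ p) ℤ.^ m
pos-^ p zero = refl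
pos-^ p (suc m) = trans (ℤP.pos-* p (p ℕ.^ m)) (cong (+ p ℤ.*_) (pos-^ p m))


module _ {p : ℕ} (pr : Prime p) where

  private
    p^1+m≢0 : ∀ m → NonZero (p ℕ.^ suc m)
    p^1+m≢0 m = ℕP.m^n≢0 p (suc m) {{prime⇒nonZero pr}}

    d : ℕ → ℕ
    d m = ℕ.pred (p ℕ.^ suc m)

    +1+d : ∀ m → + suc (d m) ≡ (+ p) ℤ.^ suc m
    +1+d m = trans (cong +_ (ℕP.suc-pred (p ℕ.^ suc m) {{p^1+m≢0 m}})) (pos-^ p (suc m))

    negPow-neg : ∀ m → negPow p pr -[1+ m ] ≡ ((ℤ.- + 1) ℤ.^ suc m) /1+ d m
    negPow-neg m = /-pred ((ℤ.- + 1) ℤ.^ suc m) (p ℕ.^ suc m) {{p^1+m≢0 m}}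

  negPow-suc : ∀ z → negPow p pr (z ℤ.+ + 1) ≡ negPow p pr z * fromℤ (ℤ.- + p)
  negPow-suc (+ m) = trans (cong (λ t → fromℤ ((ℤ.- + p) ℤ.^ t)) (ℕP.+-comm m 1))
    (trans (fromℤ-* (ℤ.- + p) ((ℤ.- + p) ℤ.^ m)) (ℚP.*-comm (fromℤ (ℤ.- + p)) _))
  negPow-suc -[1+ zero ] = sym (begin
    negPow p pr -[1+ 0 ] * fromℤ (ℤ.- + p)        ≡⟨ cong (_* fromℤ (ℤ.- + p)) (negPow-neg 0) ⟩
    ((ℤ.- + 1) ℤ.^ 1) /1+ d 0 * fromℤ (ℤ.- + p)   ≡⟨ /1+-*-fromℤ ((ℤ.- + 1) ℤ.^ 1) (d 0) (ℤ.- + p) ⟩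
    ((ℤ.- + 1) ℤ.^ 1 ℤ.* ℤ.- + p) /1+ d 0         ≡⟨ /1+-cong {(ℤ.- + 1) ℤ.^ 1 ℤ.* ℤ.- + p} {d 0} {+ 1} {0} (trans (cancel (+ p)) (cong (+ 1 ℤ.*_) (sym (+1+d 0)))) ⟩
    1ℚ                                            ∎)
    where
    cancel : ∀ P → (((ℤ.- + 1) ℤ.* + 1) ℤ.* ℤ.- P) ℤ.* + 1 ≡ + 1 ℤ.* (P ℤ.* + 1)
    cancel = ℤSolver.solve-∀
  negPow-suc -[1+ suc m ] = sym (begin
    negPow p pr -[1+ suc m ] * fromℤ (ℤ.- + p)        ≡⟨ cong (_* fromℤ (ℤ.- + p)) (negPow-neg (suc m)) ⟩
    A₂ /1+ d (suc m) * fromℤ (ℤ.- + p)                 ≡⟨ /1+-*-fromℤ A₂ (d (suc m)) (ℤ.- + p) ⟩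
    (A₂ ℤ.* ℤ.- + p) /1+ d (suc m)                     ≡⟨ /1+-cong {A₂ ℤ.* ℤ.- + p} {d (suc m)} {A₁} {d m} cross ⟩
    A₁ /1+ d m                                         ≡⟨ sym (negPow-neg m) ⟩
    negPow p pr -[1+ m ]                               ∎)
    where
    A₁ = (ℤ.- + 1) ℤ.^ suc m
    A₂ = (ℤ.- + 1) ℤ.^ suc (suc m)
    cancel : ∀ A P Q → (((ℤ.- + 1) ℤ.* A) ℤ.* ℤ.- P) ℤ.* Q ≡ A ℤ.* (P ℤ.* Q)
    cancel = ℤSolver.solve-∀
    cross : (A₂ ℤ.* ℤ.- + p) ℤ.* + suc (d m) ≡ A₁ ℤ.* + suc (d (suc m))
    cross = trans (cong ((A₂ ℤ.* ℤ.- + p) ℤ.*_) (+1+d m))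
      (trans (cancel A₁ (+ p) ((+ p) ℤ.^ suc m)) (cong (A₁ ℤ.*_) (sym (+1+d (suc m)))))

  negPow-pred : ∀ z → negPow p pr (z ℤ.+ -[1+ 0 ]) ≡ negPow p pr z * negPow p pr -[1+ 0 ]
  negPow-pred z = begin
    x                                 ≡⟨ sym (ℚP.*-identityʳ x) ⟩
    x * 1ℚ                            ≡⟨ cong (x *_) (trans (negPow-suc -[1+ 0 ]) (ℚP.*-comm q P)) ⟩
    x * (P * q)                       ≡⟨ sym (ℚP.*-assoc x P q) ⟩
    x * P * q                         ≡⟨ cong (_* q) (sym (negPow-suc (z ℤ.+ -[1+ 0 ]))) ⟩
    negPow p pr (z ℤ.- + 1 ℤ.+ + 1) * q ≡⟨ cong (λ t → negPow p pr t * q) (cancel z) ⟩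
    negPow p pr z * q                 ∎
    where
    x = negPow p pr (z ℤ.+ -[1+ 0 ])
    q = negPow p pr -[1+ 0 ]
    P = fromℤ (ℤ.- + p)
    cancel : ∀ z → z ℤ.- + 1 ℤ.+ + 1 ≡ z
    cancel = ℤSolver.solve-∀

  negPow-+ : ∀ a b → negPow p pr (a ℤ.+ b) ≡ negPow p pr a * negPow p pr b
  negPow-+ a (+ zero) = trans (cong (negPow p pr) (ℤP.+-identityʳ a)) (sym (ℚP.*-identityʳ _))
  negPow-+ a (+ suc n) = begin
    negPow p pr (a ℤ.+ + suc n)                     ≡⟨ cong (negPow p pr) (shift a (+ n)) ⟩
    negPow p pr (a ℤ.+ + n ℤ.+ + 1)                 ≡⟨ negPow-suc (a ℤ.+ + n) ⟩
    negPow p pr (a ℤ.+ + n) * P                     ≡⟨ cong (_* P) (negPow-+ a (+ n)) ⟩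
    negPow p pr a * negPow p pr (+ n) * P           ≡⟨ ℚP.*-assoc (negPow p pr a) _ P ⟩
    negPow p pr a * (negPow p pr (+ n) * P)         ≡⟨ cong (negPow p pr a *_) (negPow-suc (+ n)) ⟨
    negPow p pr a * negPow p pr (+ (n ℕ.+ 1))       ≡⟨ cong (λ t → negPow p pr a * negPow p pr (+ t)) (ℕP.+-comm n 1) ⟩
    negPow p pr a * negPow p pr (+ suc n)           ∎
    where
    P = fromℤ (ℤ.- + p)
    shift : ∀ a n → a ℤ.+ (+ 1 ℤ.+ n) ≡ a ℤ.+ n ℤ.+ + 1
    shift = ℤSolver.solve-∀
  negPow-+ a -[1+ zero ] = negPow-pred a
  negPow-+ a -[1+ suc n ] = begin
    negPow p pr (a ℤ.+ -[1+ suc n ])                ≡⟨ cong (negPow p pr) a-1-n-1 ⟩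
    negPow p pr (a ℤ.+ -[1+ n ] ℤ.+ -[1+ 0 ])       ≡⟨ negPow-pred (a ℤ.+ -[1+ n ]) ⟩
    negPow p pr (a ℤ.+ -[1+ n ]) * q                ≡⟨ cong (_* q) (negPow-+ a -[1+ n ]) ⟩
    negPow p pr a * negPow p pr -[1+ n ] * q        ≡⟨ ℚP.*-assoc (negPow p pr a) _ q ⟩
    negPow p pr a * (negPow p pr -[1+ n ] * q)      ≡⟨ cong (negPow p pr a *_) (negPow-pred -[1+ n ]) ⟨
    negPow p pr a * negPow p pr -[1+ suc (n ℕ.+ 0) ] ≡⟨ cong (λ t → negPow p pr a * negPow p pr -[1+ suc t ]) (ℕP.+-identityʳ n) ⟩
    negPow p pr a * negPow p pr -[1+ suc n ]        ∎
    where
    q = negPow p pr -[1+ 0 ]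
    a-1-n-1 : a ℤ.+ -[1+ suc n ] ≡ a ℤ.+ -[1+ n ] ℤ.+ -[1+ 0 ]
    a-1-n-1 = trans (cong (λ t → a ℤ.+ -[1+ suc t ]) (sym (ℕP.+-identityʳ n))) (sym (ℤP.+-assoc a -[1+ n ] -[1+ 0 ]))

*<⇒≡0 : ∀ {a K} → a ℕ.* K < K → a ≡ 0
*<⇒≡0 {zero} _ = refl
*<⇒≡0 {suc a} {K} aK<K = ⊥-elim (ℕP.<-irrefl refl (ℕP.<-≤-trans aK<K (ℕP.m≤m+n K (a ℕ.* K))))

quotient-unique : ∀ {K r q r′ q′} → r < K → r′ < K → + r ℤ.+ q ℤ.* + K ≡ + r′ ℤ.+ q′ ℤ.* + K → q ≡ q′
quotient-unique {K} {r} {q} {r′} {q′} r<K r′<K eq = ℤP.i-j≡0⇒i≡j q q′ (ℤP.∣i∣≡0⇒i≡0 (*<⇒≡0 ∣q-q′∣K<K))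
  where
  expand : ∀ r q r′ q′ K → (q ℤ.- q′) ℤ.* K ≡ (r′ ℤ.- r) ℤ.+ ((r ℤ.+ q ℤ.* K) ℤ.- (r′ ℤ.+ q′ ℤ.* K))
  expand = ℤSolver.solve-∀
  [q-q′]K≡r′-r : (q ℤ.- q′) ℤ.* + K ≡ + r′ ℤ.- + r
  [q-q′]K≡r′-r = begin
    (q ℤ.- q′) ℤ.* + K                      ≡⟨ expand (+ r) q (+ r′) q′ (+ K) ⟩
    (+ r′ ℤ.- + r) ℤ.+ (X ℤ.- Y)            ≡⟨ cong (λ t → (+ r′ ℤ.- + r) ℤ.+ (t ℤ.- Y)) eq ⟩
    (+ r′ ℤ.- + r) ℤ.+ (Y ℤ.- Y)            ≡⟨ cong (λ t → (+ r′ ℤ.- + r) ℤ.+ t) (ℤP.+-inverseʳ Y) ⟩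
    (+ r′ ℤ.- + r) ℤ.+ + 0                  ≡⟨ ℤP.+-identityʳ _ ⟩
    + r′ ℤ.- + r                            ∎
    where
    X = + r ℤ.+ q ℤ.* + K
    Y = + r′ ℤ.+ q′ ℤ.* + K
  ∣q-q′∣K<K : ℤ.∣ q ℤ.- q′ ∣ ℕ.* K < K
  ∣q-q′∣K<K = subst (_< K)
    (sym (trans (sym (ℤP.abs-* (q ℤ.- q′) (+ K))) (cong ℤ.∣_∣ (trans [q-q′]K≡r′-r (ℤP.m-n≡m⊖n r′ r)))))
    (ℕP.≤-<-trans (ℤP.∣m⊝n∣≤m⊔n r′ r) (ℕP.⊔-lub r′<K r<K))

divMod-unique : ∀ K .{{_ : NonZero K}} z r q → r < K → z ≡ + r ℤ.+ q ℤ.* + K →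
                z ℤ.%ℕ K ≡ r × z ℤ./ℕ K ≡ q
divMod-unique K z r q r<K z≡ = ℤP.+-injective r₀≡r , sym q≡q₀
  where
  r₀ = z ℤ.%ℕ K
  q₀ = z ℤ./ℕ K
  z≡₀ : z ≡ + r₀ ℤ.+ q₀ ℤ.* + K
  z≡₀ = ℤDM.a≡a%ℕn+[a/ℕn]*n z K
  q≡q₀ : q ≡ q₀
  q≡q₀ = quotient-unique r<K (ℤDM.n%ℕd<d z K) (trans (sym z≡) z≡₀)
  remainder : ∀ r q → r ≡ r ℤ.+ q ℤ.- q
  remainder = ℤSolver.solve-∀
  r₀≡r : + r₀ ≡ + r
  r₀≡r = begin
    + r₀                                  ≡⟨ remainder (+ r₀) (q₀ ℤ.* + K) ⟩
    + r₀ ℤ.+ q₀ ℤ.* + K ℤ.- q₀ ℤ.* + K    ≡⟨ cong (ℤ._- q₀ ℤ.* + K) (trans (sym z≡₀) z≡) ⟩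
    + r ℤ.+ q ℤ.* + K ℤ.- q₀ ℤ.* + K      ≡⟨ cong (λ t → + r ℤ.+ t ℤ.* + K ℤ.- q₀ ℤ.* + K) q≡q₀ ⟩
    + r ℤ.+ q₀ ℤ.* + K ℤ.- q₀ ℤ.* + K     ≡⟨ remainder (+ r) (q₀ ℤ.* + K) ⟨
    + r                                   ∎

-m+n≡n∸m : ∀ {m n} → m ≤ n → ℤ.- + m ℤ.+ + n ≡ + (n ℕ.∸ m)
-m+n≡n∸m {m} {n} m≤n = trans (ℤP.+-comm (ℤ.- + m) (+ n)) (trans (ℤP.m-n≡m⊖n n m) (ℤP.⊖-≥ m≤n))

zipWith-−-self : ∀ {n} (v : Vec ℤ n) → zipWith ℤ._-_ v v ≡ vzero
zipWith-−-self [] = refl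
zipWith-−-self (x ∷ v) = cong₂ _∷_ (ℤP.+-inverseʳ x) (zipWith-−-self v)

vadd-zipWith-− : ∀ {n} (b X Y : Vec ℤ n) x y →
  vadd (map ((x ℤ.- y) ℤ.*_) b) (zipWith ℤ._-_ X Y)
    ≡ zipWith ℤ._-_ (vadd (map (x ℤ.*_) b) X) (vadd (map (y ℤ.*_) b) Y)
vadd-zipWith-− [] [] [] x y = refl
vadd-zipWith-− (b ∷ bs) (X ∷ Xs) (Y ∷ Ys) x y = cong₂ _∷_ (distrib b X Y x y) (vadd-zipWith-− bs Xs Ys x y)
  where
  distrib : ∀ b X Y x y → (x ℤ.- y) ℤ.* b ℤ.+ (X ℤ.- Y) ≡ (x ℤ.* b ℤ.+ X) ℤ.- (y ℤ.* b ℤ.+ Y)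
  distrib = ℤSolver.solve-∀

lincomb-− : ∀ {n N} (a : Fin N → Vec ℤ n) (x y : Fin N → ℤ) →
  lincomb a (λ i → x i ℤ.- y i) ≡ zipWith ℤ._-_ (lincomb a x) (lincomb a y)
lincomb-− {N = zero} a x y = sym (zipWith-−-self vzero)
lincomb-− {N = suc N} a x y =
  trans (cong (vadd (map ((x fzero ℤ.- y fzero) ℤ.*_) (a fzero))) (lincomb-− (a ∘ fsuc) (x ∘ fsuc) (y ∘ fsuc)))
        (vadd-zipWith-− (a fzero) (lincomb (a ∘ fsuc) (x ∘ fsuc)) (lincomb (a ∘ fsuc) (y ∘ fsuc)) (x fzero) (y fzero))

InL-lOf : ∀ {n N} (a : Fin N → Vec ℤ n) {γ} (u e : Fin N → ℕ) → InU a γ u → InU a γ e → InL a (lOf u e)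
InL-lOf a {γ} u e u∈ e∈ =
  trans (lincomb-− a (ofℕ e) (ofℕ u)) (trans (cong₂ (zipWith ℤ._-_) e∈ u∈) (zipWith-−-self γ))

↥-fromℤ : ∀ a → ℚ.↥ (fromℤ a) ≡ a
↥-fromℤ a = trans (sym (ℤP.*-identityʳ (ℚ.↥ (fromℤ a))))
  (trans (cong (λ t → ℚ.↥ (fromℤ a) ℤ.* + t) (sym (ℕG.gcd-zeroʳ ℤ.∣ a ∣))) (ℚP.↥-/ a 1))

↧-fromℤ : ∀ a → ℚ.↧ₙ (fromℤ a) ≡ 1
↧-fromℤ a = cong ℤ.∣_∣ (trans (sym (ℤP.*-identityʳ (ℚ.↧ (fromℤ a))))
  (trans (cong (λ t → ℚ.↧ (fromℤ a) ℤ.* + t) (sym (ℕG.gcd-zeroʳ ℤ.∣ a ∣))) (ℚP.↧-/ a 1)))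

isNegInt-fromℤ : ∀ a → isNegInt (fromℤ a) ≡ not (+ 0 ℤ.≤ᵇ a)
isNegInt-fromℤ a = cong₂ (λ d n → (d ℕ.≡ᵇ 1) ∧ not (+ 0 ℤ.≤ᵇ n)) (↧-fromℤ a) (↥-fromℤ a)

isNegInt-nonInteger : ∀ x → (∀ n → x ≢ fromℤ n) → isNegInt x ≡ false
isNegInt-nonInteger x x∉ℤ with ℚ.↧ₙ x ℕ.≡ᵇ 1 in eq
... | false = refl
... | true = ⊥-elim (x∉ℤ (ℚ.↥ x) (denominator-1 x (ℕP.≡ᵇ⇒≡ _ 1 (subst T (sym eq) _))))
  where
  denominator-1 : ∀ x → ℚ.↧ₙ x ≡ 1 → x ≡ fromℤ (ℚ.↥ x)
  denominator-1 x@(mkℚ _ zero _) _ = sym (ℚP.↥p/↧p≡p x)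

isNegInt-+-nonInteger : ∀ x → (∀ n → x ≢ fromℤ n) → ∀ z → isNegInt (x ℚ.+ fromℤ z) ≡ isNegInt x
isNegInt-+-nonInteger x x∉ℤ z = trans (isNegInt-nonInteger (x ℚ.+ fromℤ z) x+z∉ℤ) (sym (isNegInt-nonInteger x x∉ℤ))
  where
  cancel : ∀ x y → x ℚ.+ y ℚ.- y ≡ x
  cancel = solve-∀ ℚ-ring
  x+z∉ℤ : ∀ n → x ℚ.+ fromℤ z ≢ fromℤ n
  x+z∉ℤ n eq = x∉ℤ (n ℤ.- z) (trans (sym (cancel x (fromℤ z)))
    (trans (cong (ℚ._- fromℤ z) eq) (sym (fromℤ-− n z))))

vzero-nonInteger : ∀ k {u} → 0 < u → u < suc k → ∀ n → (ℤ.- + u) /1+ k ≢ fromℤ n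
vzero-nonInteger k {u} 0<u u<K n eq = impossible ℤ.∣ n ∣ u≡∣n∣K
  where
  cross : (ℤ.- + u) ℤ.* + 1 ≡ n ℤ.* + suc k
  cross with ℚᵘP.≃-trans (ℚᵘP.≃-sym (toℚᵘ-/1+ (ℤ.- + u) k)) (ℚᵘP.≃-trans (ℚP.toℚᵘ-cong eq) (toℚᵘ-/1+ n 0))
  ... | *≡* e = e
  u≡∣n∣K : u ℕ.* 1 ≡ ℤ.∣ n ∣ ℕ.* suc k
  u≡∣n∣K = trans (cong (ℕ._* 1) (sym (ℤP.∣-i∣≡∣i∣ (+ u))))
    (trans (sym (ℤP.abs-* (ℤ.- + u) (+ 1))) (trans (cong ℤ.∣_∣ cross) (ℤP.abs-* n (+ suc k))))
  impossible : ∀ m → u ℕ.* 1 ≡ m ℕ.* suc k → ⊥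
  impossible zero    u≡0 = ℕP.<⇒≢ 0<u (sym (trans (sym (ℕP.*-identityʳ u)) u≡0))
  impossible (suc m) u≡  = ℕP.<⇒≱ u<K (subst (suc k ≤_) (trans (sym u≡) (ℕP.*-identityʳ u))
    (ℕP.m≤m+n (suc k) (m ℕ.* suc k)))

-- −u/(1+k) is an integer only for u = 0 and u = 1+k, where v + l is e resp. e − (2+k) < 0
isNegInt-vzero-+-lOf : ∀ k {u e} → u ≤ suc k → e ≤ suc k →
  isNegInt ((ℤ.- + u) /1+ k ℚ.+ fromℤ (+ e ℤ.- + u)) ≡ isNegInt ((ℤ.- + u) /1+ k)
isNegInt-vzero-+-lOf k {zero} {e} _ _ = begin
  isNegInt (+ 0 /1+ k ℚ.+ fromℤ (+ e ℤ.- + 0))   ≡⟨ cong isNegInt v+l≡e ⟩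
  isNegInt (fromℕ e)                             ≡⟨ isNegInt-fromℤ (+ e) ⟩
  false                                          ≡⟨ cong isNegInt (ℚP.0/n≡0 (suc k)) ⟨
  isNegInt (+ 0 /1+ k)                           ∎
  where
  v+l≡e : + 0 /1+ k ℚ.+ fromℤ (+ e ℤ.- + 0) ≡ fromℕ e
  v+l≡e = trans (cong₂ ℚ._+_ (ℚP.0/n≡0 (suc k)) (cong fromℤ (ℤP.+-identityʳ (+ e)))) (ℚP.+-identityˡ (fromℕ e))
isNegInt-vzero-+-lOf k {suc u} {e} u≤K e≤K with ℕP.m≤n⇒m<n∨m≡n u≤K
... | inj₁ u<K = isNegInt-+-nonInteger _ (vzero-nonInteger k ℕ.z<s u<K) (+ e ℤ.- + suc u)
... | inj₂ refl = begin
  isNegInt ((ℤ.- + K) /1+ k ℚ.+ fromℤ (+ e ℤ.- + K))   ≡⟨ cong (λ t → isNegInt (t ℚ.+ fromℤ (+ e ℤ.- + K))) v≡-1 ⟩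
  isNegInt (fromℤ -[1+ 0 ] ℚ.+ fromℤ (+ e ℤ.- + K))    ≡⟨ cong isNegInt (sym (fromℤ-+ -[1+ 0 ] (+ e ℤ.- + K))) ⟩
  isNegInt (fromℤ (-[1+ 0 ] ℤ.+ (+ e ℤ.- + K)))        ≡⟨ cong (isNegInt ∘ fromℤ) v+l≡ ⟩
  isNegInt (fromℤ -[1+ K ℕ.∸ e ])                      ≡⟨ isNegInt-fromℤ -[1+ K ℕ.∸ e ] ⟩
  true                                                 ≡⟨ isNegInt-fromℤ -[1+ 0 ] ⟨
  isNegInt (fromℤ -[1+ 0 ])                            ≡⟨ cong isNegInt v≡-1 ⟨
  isNegInt ((ℤ.- + K) /1+ k)                           ∎
  where
  K = suc k
  v≡-1 : (ℤ.- + K) /1+ k ≡ fromℤ -[1+ 0 ]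
  v≡-1 = /1+-cong {ℤ.- + K} {k} { -[1+ 0 ]} {0} (trans (ℤP.*-identityʳ (ℤ.- + K)) (sym (ℤP.-1*i≡-i (+ K))))
  -1-t : ∀ t → -[1+ 0 ] ℤ.+ ℤ.- + t ≡ -[1+ t ]
  -1-t zero    = refl
  -1-t (suc t) = refl
  v+l≡ : -[1+ 0 ] ℤ.+ (+ e ℤ.- + K) ≡ -[1+ K ℕ.∸ e ]
  v+l≡ = trans (cong (λ t → -[1+ 0 ] ℤ.+ t) (trans (ℤP.m-n≡m⊖n e K) (ℤP.⊖-≤ e≤K))) (-1-t (K ℕ.∸ e))

nsupp-vzero-lOf : ∀ k {N} (u e : Fin N → ℕ) → (∀ i → u i ≤ suc k) → (∀ i → e i ≤ suc k) →
  nsupp (qadd (λ i → (ℤ.- + u i) /1+ k) (lOf u e)) ≡ nsupp (λ i → (ℤ.- + u i) /1+ k)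
nsupp-vzero-lOf k u e u≤K e≤K = VecP.tabulate-cong (λ i → isNegInt-vzero-+-lOf k (u≤K i) (e≤K i))

if-T : ∀ {A : Set} {b} {x y : A} → T b → (if b then x else y) ≡ x
if-T {b = true} _ = refl

if-¬T : ∀ {A : Set} {b} {x y : A} → ¬ T b → (if b then x else y) ≡ y
if-¬T {b = true}  ¬t = ⊥-elim (¬t _)
if-¬T {b = false} _  = refl

foldFin-addπ : ∀ q {N} (F : Fin N → Qπ q) j → foldFin (zeroπ q) (addπ q) F j ≡ sumℚ (λ i → F i j)
foldFin-addπ q {zero} F j = refl
foldFin-addπ q {suc N} F j = cong (F fzero j ℚ.+_) (foldFin-addπ q (F ∘ fsuc) j)

constπ-0ℚ : ∀ q j → constπ q 0ℚ j ≡ 0ℚ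
constπ-0ℚ q j with toℕ j ℕ.≡ᵇ 0
... | true  = refl
... | false = refl

-- p = 2 + k makes p ∸ 1 = suc k definitionally, so that vzeroOf and monoπ compute

module Coefficients (k : ℕ) (pr : Prime (suc (suc k))) where

  open Localisation pr

  p K : ℕ
  p = suc (suc k)
  K = suc k

  vzero-ℤ₍ₚ₎ : ∀ u → ℤ₍ₚ₎ ((ℤ.- + u) /1+ k)
  vzero-ℤ₍ₚ₎ u = representation (ℤ.- + u) k (p∤-< ℕ.z<s (ℕP.n<1+n K)) refl

  vzero≡ₚ : ∀ u → (ℤ.- + u) /1+ k ≡ₚ fromℕ u
  vzero≡ₚ u = mod-p (p* (ℤ.- + u) /1+ k ∣ vzero-ℤ₍ₚ₎ u , (begin
    (ℤ.- + u) /1+ k ℚ.- fromℕ u                ≡⟨ cong ((ℤ.- + u) /1+ k ℚ.+_) (sym (fromℤ-neg (+ u))) ⟩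
    (ℤ.- + u) /1+ k ℚ.+ fromℤ (ℤ.- + u)        ≡⟨ /1+-+-fromℤ (ℤ.- + u) k (ℤ.- + u) ⟩
    (ℤ.- + u ℤ.+ ℤ.- + u ℤ.* + K) /1+ k        ≡⟨ cong (_/1+ k) (collect (+ u) (+ K)) ⟩
    ((+ 1 ℤ.+ + K) ℤ.* ℤ.- + u) /1+ k          ≡⟨ cong (λ t → (t ℤ.* ℤ.- + u) /1+ k) (sym (ℤP.pos-+ 1 K)) ⟩
    (+ p ℤ.* ℤ.- + u) /1+ k                    ≡⟨ sym (fromℤ-*-/1+ (+ p) (ℤ.- + u) k) ⟩
    fromℕ p * (ℤ.- + u) /1+ k                  ∎))
    where
    collect : ∀ U S → ℤ.- U ℤ.+ ℤ.- U ℤ.* S ≡ (+ 1 ℤ.+ S) ℤ.* ℤ.- U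
    collect = ℤSolver.solve-∀

  bracketQuotient : ∀ {N} → (Fin N → ℕ) → (Fin N → ℕ) → ℚ
  bracketQuotient u e =
    divℚ (bracketMinus (vzeroOf p pr u) (lOf u e)) (bracketPlus (vzeroOf p pr u) (lOf u e))

  module _ {N} (u e : Fin N → ℕ) (e<p : ∀ i → e i < p) where

    private
      v = vzeroOf p pr u
      l = lOf u e
      v∈ : ∀ i → ℤ₍ₚ₎ (v i)
      v∈ i = vzero-ℤ₍ₚ₎ (u i)
      u∈ : ∀ i → ℤ₍ₚ₎ (fromℕ (u i))
      u∈ i = ℤ₍ₚ₎-fromℤ (+ u i)
      v≡u : ∀ i → v i ≡ₚ fromℕ (u i)
      v≡u i = vzero≡ₚ (u i)
      B⁺v⁻¹ : Invertible (bracketPlus v l)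
      B⁺v⁻¹ = bracketPlus-Invertible u e v≡u e<p
      B⁺u⁻¹ : Invertible (bracketPlus (fromℕ ∘ u) l)
      B⁺u⁻¹ = bracketPlus-Invertible u e (λ i → ≡ₚ-refl) e<p
      quotient≡ : bracketQuotient u e ≡ bracketMinus v l * Invertible.inverse B⁺v⁻¹
      quotient≡ = divℚ-by-inverse {bracketMinus v l} {bracketPlus v l} (Invertible.*-inverse B⁺v⁻¹)

    bracketQuotient-ℤ₍ₚ₎ : ℤ₍ₚ₎ (bracketQuotient u e)
    bracketQuotient-ℤ₍ₚ₎ =
      subst ℤ₍ₚ₎ (sym quotient≡) (ℤ₍ₚ₎-* (bracketMinus-ℤ₍ₚ₎ l v∈) (Invertible.inverse∈ B⁺v⁻¹))

    bracketQuotient-≡ₚ : bracketQuotient u e ≡ₚ factProd u * prodℚ (invFactorial ∘ e)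
    bracketQuotient-≡ₚ =
      subst₂ _≡ₚ_ (sym quotient≡) (bracket-quotient-fromℕ u e (Invertible.*-inverse B⁺u⁻¹))
        (≡ₚ-* (bracketMinus-ℤ₍ₚ₎ l u∈) (Invertible.inverse∈ B⁺v⁻¹) (bracketMinus-≡ₚ l v∈ u∈ v≡u)
              (inverse-≡ₚ B⁺v⁻¹ B⁺u⁻¹ (bracketPlus-≡ₚ l v∈ u∈ v≡u)))

  monoπ-0ℚ : ∀ z j → monoπ p pr 0ℚ z j ≡ 0ℚ
  monoπ-0ℚ z j with toℕ j ℕ.≡ᵇ z ℤ.%ℕ K
  ... | true  = ℚP.*-zeroˡ (negPow p pr (z ℤ./ℕ K))
  ... | false = refl

  mulπpow-zeroπ : ∀ m j → mulπpow p pr m (zeroπ p) j ≡ 0ℚ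
  mulπpow-zeroπ m j = trans (foldFin-addπ p {K} (λ i → monoπ p pr 0ℚ (m ℤ.+ + toℕ i)) j)
    (sumℚ-zero {K} (λ i → monoπ p pr 0ℚ (m ℤ.+ + toℕ i) j) (λ i → monoπ-0ℚ (m ℤ.+ + toℕ i) j))

  -- π^(p−1) = −p
  monoπ-negPow : ∀ c q z j → monoπ p pr (c * negPow p pr q) z j ≡ monoπ p pr c (z ℤ.+ q ℤ.* + K) j
  monoπ-negPow c q z j = begin
    (if toℕ j ℕ.≡ᵇ r then c * negPow p pr q * negPow p pr s else 0ℚ)
      ≡⟨ cong (λ t → if toℕ j ℕ.≡ᵇ r then t else 0ℚ) c*q*s≡ ⟩
    (if toℕ j ℕ.≡ᵇ r then c * negPow p pr (s ℤ.+ q) else 0ℚ)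
      ≡⟨ cong₂ (λ a b → if toℕ j ℕ.≡ᵇ a then c * negPow p pr b else 0ℚ) (sym r′≡r) (sym q′≡s+q) ⟩
    monoπ p pr c (z ℤ.+ q ℤ.* + K) j ∎
    where
    r = z ℤ.%ℕ K
    s = z ℤ./ℕ K
    regroup : ∀ r s q K → r ℤ.+ s ℤ.* K ℤ.+ q ℤ.* K ≡ r ℤ.+ (s ℤ.+ q) ℤ.* K
    regroup = ℤSolver.solve-∀
    z+qK≡ : z ℤ.+ q ℤ.* + K ≡ + r ℤ.+ (s ℤ.+ q) ℤ.* + K
    z+qK≡ = trans (cong (ℤ._+ q ℤ.* + K) (ℤDM.a≡a%ℕn+[a/ℕn]*n z K)) (regroup (+ r) s q (+ K))
    r′≡r : (z ℤ.+ q ℤ.* + K) ℤ.%ℕ K ≡ r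
    r′≡r = proj₁ (divMod-unique K (z ℤ.+ q ℤ.* + K) r (s ℤ.+ q) (ℤDM.n%ℕd<d z K) z+qK≡)
    q′≡s+q : (z ℤ.+ q ℤ.* + K) ℤ./ℕ K ≡ s ℤ.+ q
    q′≡s+q = proj₂ (divMod-unique K (z ℤ.+ q ℤ.* + K) r (s ℤ.+ q) (ℤDM.n%ℕd<d z K) z+qK≡)
    c*q*s≡ : c * negPow p pr q * negPow p pr s ≡ c * negPow p pr (s ℤ.+ q)
    c*q*s≡ = trans (ℚP.*-assoc c _ _)
      (cong (c *_) (trans (ℚP.*-comm (negPow p pr q) _) (sym (negPow-+ pr s q))))

  mulπpow-monoπ : ∀ c z m j → mulπpow p pr m (monoπ p pr c z) j ≡ monoπ p pr c (m ℤ.+ z) j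
  mulπpow-monoπ c z m j = begin
    mulπpow p pr m (monoπ p pr c z) j
      ≡⟨ foldFin-addπ p {K} (λ i → monoπ p pr (monoπ p pr c z i) (m ℤ.+ + toℕ i)) j ⟩
    sumℚ (λ i → monoπ p pr (monoπ p pr c z i) (m ℤ.+ + toℕ i) j)
      ≡⟨ sumℚ-single _ r<K vanishes-off-r ⟩
    monoπ p pr (monoπ p pr c z i₀) (m ℤ.+ + toℕ i₀) j
      ≡⟨ cong₂ (λ a b → monoπ p pr a (m ℤ.+ + b) j) at-r (FinP.toℕ-fromℕ< r<K) ⟩
    monoπ p pr (c * negPow p pr s) (m ℤ.+ + r) j
      ≡⟨ monoπ-negPow c s (m ℤ.+ + r) j ⟩
    monoπ p pr c (m ℤ.+ + r ℤ.+ s ℤ.* + K) j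
      ≡⟨ cong (λ t → monoπ p pr c t j) (trans (ℤP.+-assoc m (+ r) (s ℤ.* + K)) (cong (λ t → m ℤ.+ t) (sym z≡))) ⟩
    monoπ p pr c (m ℤ.+ z) j ∎
    where
    r = z ℤ.%ℕ K
    s = z ℤ./ℕ K
    r<K : r < K
    r<K = ℤDM.n%ℕd<d z K
    i₀ = fromℕ< r<K
    z≡ : z ≡ + r ℤ.+ s ℤ.* + K
    z≡ = ℤDM.a≡a%ℕn+[a/ℕn]*n z K
    at-r : monoπ p pr c z i₀ ≡ c * negPow p pr s
    at-r = if-T (ℕP.≡⇒≡ᵇ _ r (FinP.toℕ-fromℕ< r<K))
    vanishes-off-r : ∀ i → toℕ i ≢ r → monoπ p pr (monoπ p pr c z i) (m ℤ.+ + toℕ i) j ≡ 0ℚ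
    vanishes-off-r i i≢r = trans (cong (λ t → monoπ p pr t (m ℤ.+ + toℕ i) j) (if-¬T (i≢r ∘ ℕP.≡ᵇ⇒≡ _ r)))
      (monoπ-0ℚ (m ℤ.+ + toℕ i) j)

  monoπ-ℤ₍ₚ₎ : ∀ {c} → ℤ₍ₚ₎ c → ∀ m j → ℤ₍ₚ₎ (monoπ p pr c (+ m) j)
  monoπ-ℤ₍ₚ₎ c∈ m j with toℕ j ℕ.≡ᵇ + m ℤ.%ℕ K
  ... | true  = ℤ₍ₚ₎-* c∈ (ℤ₍ₚ₎-fromℤ ((ℤ.- + p) ℤ.^ (m ℕ./ K)))
  ... | false = ℤ₍ₚ₎-fromℤ (+ 0)

  InπIdeal-≗ : ∀ {x y : Qπ p} → (∀ j → x j ≡ y j) → InπIdeal p pr y → InπIdeal p pr x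
  InπIdeal-≗ x≗y (b , b∈ , y≗πb) = b , b∈ , λ j → trans (x≗y j) (y≗πb j)

  monoπ-InπIdeal : ∀ {c} → ℤ₍ₚ₎ c → ∀ d → InπIdeal p pr (monoπ p pr c (+ suc d))
  monoπ-InπIdeal {c} c∈ d = monoπ p pr c (+ d) , (λ j → ℤ₍ₚ₎⇒IntZp (monoπ-ℤ₍ₚ₎ c∈ d j)) ,
    (λ j → sym (mulπpow-monoπ c (+ d) (+ 1) j))

  -- δ = p y = −π^(p−1) y, so π⁻¹ δ = −π^(p−2) y is integral
  pℤ₍ₚ₎-InπIdeal : ∀ {δ} → pℤ₍ₚ₎ δ → InπIdeal p pr (monoπ p pr δ (+ 0))
  pℤ₍ₚ₎-InπIdeal {δ} (p* y ∣ y∈ , δ≡py) = monoπ p pr δ -[1+ 0 ] , (λ j → ℤ₍ₚ₎⇒IntZp (integral j)) ,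
    (λ j → sym (mulπpow-monoπ δ -[1+ 0 ] (+ 1) j))
    where
    q = negPow p pr -[1+ 0 ]
    P = fromℤ (ℤ.- + p)
    -1≡ : ∀ k → ℤ.- + 1 ≡ k ℤ.+ (ℤ.- + 1) ℤ.* (+ 1 ℤ.+ k)
    -1≡ = ℤSolver.solve-∀
    -1/K≡-1 : -[1+ 0 ] ℤ./ℕ K ≡ -[1+ 0 ]
    -1/K≡-1 = proj₂ (divMod-unique K -[1+ 0 ] k -[1+ 0 ] (ℕP.n<1+n k) (-1≡ (+ k)))
    p≡-P : fromℕ p ≡ ℚ.- P
    p≡-P = trans (cong fromℤ (sym (ℤP.neg-involutive (+ p)))) (fromℤ-neg (ℤ.- + p))
    rearrange : ∀ P y q → ℚ.- P * y * q ≡ ℚ.- (y * (q * P))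
    rearrange = solve-∀ ℚ-ring
    δq≡-y : δ * negPow p pr (-[1+ 0 ] ℤ./ℕ K) ≡ ℚ.- y
    δq≡-y = begin
      δ * negPow p pr (-[1+ 0 ] ℤ./ℕ K)   ≡⟨ cong₂ (λ a b → a * negPow p pr b) δ≡py -1/K≡-1 ⟩
      fromℕ p * y * q                     ≡⟨ cong (λ t → t * y * q) p≡-P ⟩
      ℚ.- P * y * q                       ≡⟨ rearrange P y q ⟩
      ℚ.- (y * (q * P))                   ≡⟨ cong (λ t → ℚ.- (y * t)) (sym (negPow-suc pr -[1+ 0 ])) ⟩
      ℚ.- (y * 1ℚ)                        ≡⟨ cong ℚ.-_ (ℚP.*-identityʳ y) ⟩
      ℚ.- y                               ∎
    integral : ∀ j → ℤ₍ₚ₎ (monoπ p pr δ -[1+ 0 ] j)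
    integral j with toℕ j ℕ.≡ᵇ -[1+ 0 ] ℤ.%ℕ K
    ... | true  = subst ℤ₍ₚ₎ (sym δq≡-y) (ℤ₍ₚ₎-neg y∈)
    ... | false = ℤ₍ₚ₎-fromℤ (+ 0)

  monoπ-+0-−-constπ : ∀ c t j → monoπ p pr c (+ 0) j ℚ.- constπ p t j ≡ monoπ p pr (c ℚ.- t) (+ 0) j
  monoπ-+0-−-constπ c t j with toℕ j ℕ.≡ᵇ 0
  ... | true  = distrib c t
    where
    distrib : ∀ c t → c * 1ℚ ℚ.- t ≡ (c ℚ.- t) * 1ℚ
    distrib = solve-∀ ℚ-ring
  ... | false = ℚP.+-identityʳ 0ℚ

  InπIdeal-zeroπ : InπIdeal p pr (zeroπ p)
  InπIdeal-zeroπ = zeroπ p , (λ j → ℤ₍ₚ₎⇒IntZp (ℤ₍ₚ₎-fromℤ (+ 0))) , (λ j → sym (mulπpow-zeroπ (+ 1) j))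

  module _ {n N} (a : Fin N → Vec ℤ n) (γ : Vec ℤ n) (w : ℕ) (isW : IsW a γ w) (good : Good p a γ w)
           (u0 : Fin N → ℕ) (u0∈ : InUmin a γ w u0) (e : Fin N → ℕ) where

    private
      X : Qπ p
      X = coeffπwG p pr a γ w u0 e
      c : ℚ
      c = bracketQuotient u0 e
      Difference : Qπ p
      Difference = subπ p X (constπ p (factProd u0 * coeffF a γ w e))

    InN′ : Set
    InN′ = InL a (lOf u0 e) × nsupp (qadd (vzeroOf p pr u0) (lOf u0 e)) ≡ nsupp (vzeroOf p pr u0)
         × InUp1 p a γ e

    private
      L? : Dec (InL a (lOf u0 e))
      L? = VecP.≡-dec ℤP._≟_ (lincomb a (lOf u0 e)) vzero
      S? : Dec (nsupp (qadd (vzeroOf p pr u0) (lOf u0 e)) ≡ nsupp (vzeroOf p pr u0))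
      S? = VecP.≡-dec BoolP._≟_ (nsupp (qadd (vzeroOf p pr u0) (lOf u0 e))) (nsupp (vzeroOf p pr u0))
      U? : Dec (InU a γ e)
      U? = VecP.≡-dec ℤP._≟_ (lincomb a (ofℕ e)) γ
      B? : Dec (∀ i → e i ≤ K)
      B? = all? (λ i → e i ℕ.≤? K)
      InN′? : Dec InN′
      InN′? = L? ×-dec S? ×-dec U? ×-dec B?
      InUmin? : Dec (InUmin a γ w e)
      InUmin? = U? ×-dec weight e ℕP.≟ w

      InN′ᵇ≡ : InN'ᵇ p pr a γ u0 e ≡ ⌊ InN′? ⌋
      InN′ᵇ≡ = trans (cong₂ _∧_ (isYes≗does L?) (cong₂ _∧_ (isYes≗does S?)
                       (cong₂ _∧_ (isYes≗does U?) (isYes≗does B?))))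
                     (sym (isYes≗does InN′?))

      InUminᵇ≡ : InUminᵇ a γ w e ≡ ⌊ InUmin? ⌋
      InUminᵇ≡ = trans (cong (_∧ (weight e ℕ.≡ᵇ w)) (isYes≗does U?)) (sym (isYes≗does InUmin?))

    InN′⇒InN′ᵇ : InN′ → T (InN'ᵇ p pr a γ u0 e)
    InN′⇒InN′ᵇ = subst T (sym InN′ᵇ≡) ∘ fromWitness

    InN′ᵇ⇒InN′ : T (InN'ᵇ p pr a γ u0 e) → InN′
    InN′ᵇ⇒InN′ = toWitness ∘ subst T InN′ᵇ≡

    InUmin⇒InUminᵇ : InUmin a γ w e → T (InUminᵇ a γ w e)
    InUmin⇒InUminᵇ = subst T (sym InUminᵇ≡) ∘ fromWitness

    InUminᵇ⇒InUmin : T (InUminᵇ a γ w e) → InUmin a γ w e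
    InUminᵇ⇒InUmin = toWitness ∘ subst T InUminᵇ≡

    InUmin⇒InN′ : InUmin a γ w e → InN′
    InUmin⇒InN′ e∈Umin@(e∈U , _) =
      InL-lOf a u0 e (proj₁ u0∈) e∈U , nsupp-vzero-lOf k u0 e (proj₂ (good u0 u0∈)) (proj₂ e∈Up1) , e∈Up1
      where
      e∈Up1 : InUp1 p a γ e
      e∈Up1 = good e e∈Umin

    coeffF-InUmin : InUmin a γ w e → coeffF a γ w e ≡ prodℚ (invFactorial ∘ e)
    coeffF-InUmin = if-T ∘ InUmin⇒InUminᵇ

    constπ-F-∉Umin : ¬ InUmin a γ w e → ∀ j → constπ p (factProd u0 * coeffF a γ w e) j ≡ 0ℚ
    constπ-F-∉Umin e∉Umin j = trans (cong (λ t → constπ p (factProd u0 * t) j) (if-¬T (e∉Umin ∘ InUminᵇ⇒InUmin)))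
      (trans (cong (λ t → constπ p t j) (ℚP.*-zeroʳ (factProd u0))) (constπ-0ℚ p j))

    X-InN′ : InN′ → ∀ j → X j ≡ monoπ p pr c (+ (weight e ℕ.∸ w)) j
    X-InN′ e∈N′@(_ , _ , e∈U , _) j =
      trans (cong (λ x → mulπpow p pr (ℤ.- + w) x j) (if-T (InN′⇒InN′ᵇ e∈N′)))
        (trans (mulπpow-monoπ c (+ weight e) (ℤ.- + w) j) (cong (λ z → monoπ p pr c z j) (-m+n≡n∸m (proj₂ isW e e∈U))))

    X-∉N′ : ¬ InN′ → ∀ j → X j ≡ 0ℚ
    X-∉N′ e∉N′ j = trans (cong (λ x → mulπpow p pr (ℤ.- + w) x j) (if-¬T (e∉N′ ∘ InN′ᵇ⇒InN′)))
      (mulπpow-zeroπ (ℤ.- + w) j)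

    coefficient-∉N′ : ¬ InN′ → IntegralQπ p X × InπIdeal p pr Difference
    coefficient-∉N′ e∉N′ =
      (λ j → subst (IntZp p) (sym (X-∉N′ e∉N′ j)) (ℤ₍ₚ₎⇒IntZp (ℤ₍ₚ₎-fromℤ (+ 0)))) ,
      InπIdeal-≗ (λ j → cong₂ ℚ._-_ (X-∉N′ e∉N′ j) (constπ-F-∉Umin (e∉N′ ∘ InUmin⇒InN′) j)) InπIdeal-zeroπ

    coefficient-InN′ : InN′ → IntegralQπ p X × InπIdeal p pr Difference
    coefficient-InN′ e∈N′@(_ , _ , e∈U , e≤K) =
      (λ j → subst (IntZp p) (sym (X-InN′ e∈N′ j)) (ℤ₍ₚ₎⇒IntZp (monoπ-ℤ₍ₚ₎ c∈ (weight e ℕ.∸ w) j))) ,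
      by-excess (weight e ℕ.∸ w) refl
      where
      e<p : ∀ i → e i < p
      e<p i = s≤s (e≤K i)
      c∈ : ℤ₍ₚ₎ c
      c∈ = bracketQuotient-ℤ₍ₚ₎ u0 e e<p
      X≡ : ∀ {d} → weight e ℕ.∸ w ≡ d → ∀ j → X j ≡ monoπ p pr c (+ d) j
      X≡ |e|∸w≡d j = trans (X-InN′ e∈N′ j) (cong (λ t → monoπ p pr c (+ t) j) |e|∸w≡d)
      by-excess : ∀ d → weight e ℕ.∸ w ≡ d → InπIdeal p pr Difference
      by-excess zero |e|∸w≡0 = InπIdeal-≗
        (λ j → trans (cong₂ ℚ._-_ (X≡ |e|∸w≡0 j) (cong (λ t → constπ p (factProd u0 * t) j) (coeffF-InUmin (e∈U , |e|≡w))))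
                     (monoπ-+0-−-constπ c _ j))
        (pℤ₍ₚ₎-InπIdeal (_≡ₚ_.difference (bracketQuotient-≡ₚ u0 e e<p)))
        where
        |e|≡w : weight e ≡ w
        |e|≡w = ℕP.≤-antisym (ℕP.m∸n≡0⇒m≤n |e|∸w≡0) (proj₂ isW e e∈U)
      by-excess (suc d) |e|∸w≡1+d = InπIdeal-≗
        (λ j → trans (cong₂ ℚ._-_ (X≡ |e|∸w≡1+d j) (constπ-F-∉Umin (|e|≢w ∘ proj₂) j)) (ℚP.+-identityʳ _))
        (monoπ-InπIdeal c∈ d)
        where
        |e|≢w : weight e ≢ w
        |e|≢w |e|≡w = ℕP.0≢1+n (trans (sym (trans (cong (ℕ._∸ w) |e|≡w) (ℕP.n∸n≡0 w))) |e|∸w≡1+d)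

    coefficient : IntegralQπ p X × InπIdeal p pr Difference
    coefficient with T? (InN'ᵇ p pr a γ u0 e)
    ... | yes e∈N′ = coefficient-InN′ (InN′ᵇ⇒InN′ e∈N′)
    ... | no  e∉N′ = coefficient-∉N′ (e∉N′ ∘ InN′⇒InN′ᵇ)

proposition4p6 : (p : ℕ) (pr : Prime p) (n N : ℕ) (a : Fin N → Vec ℤ n)
    → (∀ i j → a i ≡ a j → i ≡ j)
    → (γ : Vec ℤ n) (w : ℕ) → IsW a γ w
    → Good p a γ w
    → (u0 : Fin N → ℕ) → InUmin a γ w u0
    → MinNegSupp a (vzeroOf p pr u0)
    → (e : Fin N → ℕ)
    → IntegralQπ p (coeffπwG p pr a γ w u0 e)
      × InπIdeal p pr
          (subπ p (coeffπwG p pr a γ w u0 e)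
                  (constπ p (factProd u0 * coeffF a γ w e)))
proposition4p6 zero pr = ⊥-elim (¬prime[0] pr)
proposition4p6 (suc zero) pr = ⊥-elim (¬prime[1] pr)
proposition4p6 (suc (suc k)) pr n N a _ γ w isW good u0 u0∈ _ e =
  Coefficients.coefficient k pr a γ w isW good u0 u0∈ e
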